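{- Let $R$ be a $*$-stable order in a rational Clifford algebra $K$. If $R$ is right Clifford-Euclidean, then $R$ is right cuspidally principal: for every $v\in\operatorname{Vec}(K)$ there exists $\begin{pmatrix}a&b\\c&d\end{pmatrix}\in\operatorname{SL}_2(R)$ with $c^{ -1}d=v$.
   Context: $K=\left(\frac{ -d_1,\dots,-d_m}{\mathbb{Q}}\right)$ (positive integers $d_j$; generators $\gamma_j$, $\gamma_j^2=-d_j$, anticommuting), $\operatorname{Vec}(K)=\mathbb{Q}+\sum\mathbb{Q}\gamma_j$, $\operatorname{Vec}(R)=R\cap\operatorname{Vec}(K)$. Involutions: parity $x'$ ($\gamma_j\mapsto-\gamma_j$), transpose $x^*$ (anti-automorphism fixing $\gamma_j$), $\bar x=(x')^*$; $R$ is $*$-stable if $R^*=R$. Clifford monoid $R^{\mathrm{mon}}=\{x\in R: x\bar x\in\mathbb{Q},\ x\operatorname{Vec}(K)x^*\subseteq\operatorname{Vec}(K)\}$. $\operatorname{SL}_2(R)$: matrices over $R$ with $ad^*-bc^*=1$, $ab^*=ba^*$, $cd^*=dc^*$, $a\bar a,\dots,d\bar d\in\mathbb{Z}$, $a\bar c,b\bar d\in\operatorname{Vec}$, and for all Clifford vectors $x$: $ax\bar b+b\bar x\bar a,\ cx\bar d+d\bar x\bar c$ scalars and $ax\bar d+b\bar x\bar c\in\operatorname{Vec}$. Right Clifford-Euclidean: there is $N:R^{\mathrm{mon}}\to\mathbb{N}$ with $N(x)=0$ iff $x$ is a zero-divisor, such that for all $x,y\in R^{\mathrm{mon}}$ with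 $N(x)>0$ and $xy^*\in\operatorname{Vec}(R)$ there are $q\in\operatorname{Vec}(R)$, $r\in R^{\mathrm{mon}}$ with $y=xq+r$, $N(r)<N(x)$. -}

module Defs where

open import Data.Nat using (ℕ; _<_)
open import Data.Integer using (ℤ; +_)
open import Data.Rational as ℚ using (ℚ; 0ℚ; 1ℚ)
open import Data.List using (List; []; _∷_; map)
open import Data.List.Relation.Unary.All using (All)
open import Data.Product using (Σ; ∃; _×_; _,_; proj₁; proj₂)
open import Data.Sum using (_⊎_)
open import Data.Unit using (⊤)
open import Relation.Nullary using (¬_)
open import Relation.Binary.PropositionalEquality using (_≡_)
open import Function.Bundles using (_⇔_)

-- The rational Clifford algebra K = (-d_1,...,-d_m / ℚ), built
-- recursively: for ds = δ ∷ ds', an element of Cl (δ ∷ ds') is a pair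
-- (a , b) of elements of Cl ds' standing for a + b γ, where γ is the
-- new generator with γ² = -δ, anticommuting with the generators of Cl ds'.

Cl : List ℕ → Set
Cl []       = ℚ
Cl (_ ∷ ds) = Cl ds × Cl ds

fromℕ : ℕ → ℚ
fromℕ n = (+ n) ℚ./ 1

sc : ∀ {ds} → ℚ → Cl ds
sc {[]}     q = q
sc {_ ∷ ds} q = sc {ds} q , sc {ds} 0ℚ

0K 1K : ∀ {ds} → Cl ds
0K {ds} = sc {ds} 0ℚ
1K {ds} = sc {ds} 1ℚ

infixl 6 _+K_ _-K_
infixl 7 _*K_

_+K_ : ∀ {ds} → Cl ds → Cl ds → Cl ds
_+K_ {[]}     x y = x ℚ.+ y
_+K_ {_ ∷ ds} (a , b) (c , d) = (a +K c) , (b +K d)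

-K_ : ∀ {ds} → Cl ds → Cl ds
-K_ {[]}     x = ℚ.- x
-K_ {_ ∷ ds} (a , b) = (-K a) , (-K b)

_-K_ : ∀ {ds} → Cl ds → Cl ds → Cl ds
x -K y = x +K (-K y)

-- parity involution x ↦ x' (γ_j ↦ -γ_j):  (a + bγ)' = a' - b' γ
parity : ∀ {ds} → Cl ds → Cl ds
parity {[]}     x = x
parity {_ ∷ ds} (a , b) = parity a , (-K parity b)

-- multiplication:
-- (a + bγ)(c + eγ) = (ac - δ b e') + (a e + b c') γ     (since γ c = c' γ, γ² = -δ)
_*K_ : ∀ {ds} → Cl ds → Cl ds → Cl ds
_*K_ {[]}     x y = x ℚ.* y
_*K_ {δ ∷ ds} (a , b) (c , e) =
  ((a *K c) -K (sc (fromℕ δ) *K (b *K parity e))) , ((a *K e) +K (b *K parity c))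

-- transpose x ↦ x*: anti-automorphism fixing each γ_j:
-- (a + bγ)* = a* + γ b* = a* + (b*)' γ
star : ∀ {ds} → Cl ds → Cl ds
star {[]}     x = x
star {_ ∷ ds} (a , b) = star a , parity (star b)

conj : ∀ {ds} → Cl ds → Cl ds
conj x = star (parity x)

scalarPart : ∀ {ds} → Cl ds → ℚ
scalarPart {[]}     x = x
scalarPart {_ ∷ ds} (a , _) = scalarPart a

IsScalar : ∀ {ds} → Cl ds → Set
IsScalar {ds} x = x ≡ sc {ds} (scalarPart x)

IsInt : ∀ {ds} → Cl ds → Set
IsInt {ds} x = IsScalar x × Σ ℤ (λ z → scalarPart x ≡ z ℚ./ 1)

-- x ∈ Vec(K) = ℚ + Σ ℚ γ_j
IsVec : ∀ {ds} → Cl ds → Set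
IsVec {[]}     x = ⊤
IsVec {_ ∷ ds} (a , b) = IsVec a × IsScalar b

-- zero-divisor of K (0 included)
ZeroDivisor : ∀ {ds} → Cl ds → Set
ZeroDivisor {ds} x = Σ (Cl ds) λ y → ¬ (y ≡ 0K) × ((x *K y ≡ 0K) ⊎ (y *K x ≡ 0K))

Subset : List ℕ → Set₁
Subset ds = Cl ds → Set

-- Σ_i q_i e_i (zip, extra entries ignored)
linComb : ∀ {ds} → List ℚ → List (Cl ds) → Cl ds
linComb (q ∷ qs) (e ∷ es) = (sc q *K e) +K linComb qs es
linComb _        _        = 0K

ℤ-span : ∀ {ds} → List (Cl ds) → Subset ds
ℤ-span es x = Σ (List ℤ) λ zs → x ≡ linComb (map (λ z → z ℚ./ 1) zs) es

ℚ-span : ∀ {ds} → List (Cl ds) → Subset ds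
ℚ-span es x = Σ (List ℚ) λ qs → x ≡ linComb qs es

record IsOrder {ds : List ℕ} (R : Subset ds) : Set where
  field
    one∈    : R 1K
    +-closed : ∀ {x y} → R x → R y → R (x +K y)
    neg-closed : ∀ {x} → R x → R (-K x)
    *-closed : ∀ {x y} → R x → R y → R (x *K y)
    lattice : Σ (List (Cl ds)) λ es →
                ((∀ x → R x ⇔ ℤ-span es x) × (∀ x → ℚ-span es x))

StarStable : ∀ {ds} → Subset ds → Set
StarStable {ds} R = ∀ (y : Cl ds) → (Σ (Cl ds) λ x → R x × star x ≡ y) ⇔ R y

VecR : ∀ {ds} → Subset ds → Subset ds
VecR R x = R x × IsVec x

Mon : ∀ {ds} → Subset ds → Subset ds
Mon {ds} R x = R x × IsScalar (x *K conj x)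
             × (∀ (v : Cl ds) → IsVec v → IsVec (x *K v *K star x))

record SL₂ {ds : List ℕ} (R : Subset ds) (a b c d : Cl ds) : Set where
  field
    a∈ : R a
    b∈ : R b
    c∈ : R c
    d∈ : R d
    det   : (a *K star d) -K (b *K star c) ≡ 1K
    ab    : a *K star b ≡ b *K star a
    cd    : c *K star d ≡ d *K star c
    aa    : IsInt (a *K conj a)
    bb    : IsInt (b *K conj b)
    cc    : IsInt (c *K conj c)
    dd    : IsInt (d *K conj d)
    ac    : IsVec (a *K conj c)
    bd    : IsVec (b *K conj d)
    vab   : ∀ x → IsVec x → IsScalar ((a *K x *K conj b) +K (b *K conj x *K conj a))
    vcd   : ∀ x → IsVec x → IsScalar ((c *K x *K conj d) +K (d *K conj x *K conj c))
    vad   : ∀ x → IsVec x → IsVec ((a *K x *K conj d) +K (b *K conj x *K conj c))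

-- right Clifford-Euclidean (N given as a total function K → ℕ; only its
-- values on R^mon matter)
RightCliffordEuclidean : ∀ {ds} → Subset ds → Set
RightCliffordEuclidean {ds} R =
  Σ (Cl ds → ℕ) λ N →
    (∀ x → Mon R x → (N x ≡ 0 ⇔ ZeroDivisor x)) ×
    (∀ x y → Mon R x → Mon R y → 0 < N x → VecR R (x *K star y) →
       Σ (Cl ds) λ q → Σ (Cl ds) λ r →
         VecR R q × Mon R r × (y ≡ (x *K q) +K r) × (N r < N x))

RightCuspidallyPrincipal : ∀ {ds} → Subset ds → Set
RightCuspidallyPrincipal {ds} R =
  ∀ (v : Cl ds) → IsVec v →
    Σ (Cl ds) λ a → Σ (Cl ds) λ b → Σ (Cl ds) λ c → Σ (Cl ds) λ d →
      SL₂ R a b c d ×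
      Σ (Cl ds) λ cinv → (cinv *K c ≡ 1K) × (c *K cinv ≡ 1K) × (cinv *K d ≡ v)

{-# OPTIONS --safe #-}
module Submission where

-- Euclid's algorithm, run as a continued fraction. For a vector v choose an integer c ≠ 0 with
-- c v ∈ R, and argue by induction on N c over all pairs (c , v) with c ∈ R^mon invertible and
-- c v ∈ R. Division gives c v = c q + r with q ∈ Vec(R) and N r < N c. If v = q, then v = c⁻¹d for
-- the matrix (0 1; -1 -q). Otherwise w = v - q is a nonzero vector, invertible in K because its
-- norm w w̄ is a positive rational, r = c w, and (r , -w⁻¹) is again such a pair, r (-w⁻¹) = -c
-- lying in R. A matrix for -w⁻¹, multiplied on the right by (0 1; -1 0)(1 q; 0 1), is one for
-- q + w = v. That these products stay in SL₂(R) needs x x̄ ∈ ℤ whenever x ∈ R and x x̄ ∈ ℚ: the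
-- elements xᵏ (xᵏ)‾ = (x x̄)ᵏ all lie in the lattice R, so their denominators are bounded.
-- K is built one generator at a time, and each step is a doubling A ↦ A × A preserving the ring
-- axioms together with the parity automorphism and the transpose anti-automorphism.

open import Defs
open import Algebra.Bundles using (CommutativeMonoid; CommutativeRing; Ring; Semiring)
open import Algebra.Core using (Op₁; Op₂)
import Algebra.Definitions.RawSemiring as RawSemiringDefinitions
import Algebra.Properties.CommutativeSemigroup as CommutativeSemigroupProperties
import Algebra.Properties.CommutativeSemiring.Exp as CommutativeSemiringExp
import Algebra.Properties.Ring as RingProperties
open import Algebra.Structures using (IsRing)
open import Data.Empty using (⊥-elim)
open import Data.Integer as ℤ using (ℤ; +_; ∣_∣)
import Data.Integer.Properties as ℤ
open import Data.List using (List; []; _∷_; map)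
open import Data.List.Relation.Unary.All as All using (All; []; _∷_)
open import Data.Nat as ℕ using (ℕ; zero; suc; s≤s; z≤n; _<_)
open import Data.Nat.Coprimality as Coprimality using (Coprime; coprime-divisor)
open import Data.Nat.Divisibility using (_∣_; divides; ∣-trans; ∣1⇒≡1; ∣⇒≤)
open import Data.Nat.Induction using (<-wellFounded)
import Data.Nat.Properties as ℕ
open import Data.Product using (Σ; ∃; _×_; _,_; proj₁; proj₂; swap)
import Data.Product.Properties as Product
open import Data.Rational as ℚ using (ℚ; 0ℚ; 1ℚ; mkℚ)
import Data.Rational.Properties as ℚ
import Data.Rational.Unnormalised as ℚᵘ
import Data.Rational.Unnormalised.Properties as ℚᵘ
open import Data.Sum using (inj₁; inj₂)
open import Data.Unit using (tt)
open import Function using (_∘_)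
open import Function.Bundles using (Equivalence)
open import Induction.WellFounded using (Acc; acc)
open import Level using (0ℓ)
open import Relation.Binary.Definitions using (DecidableEquality)
open import Relation.Binary.PropositionalEquality
open import Relation.Nullary using (¬_; yes; no)

open RawSemiringDefinitions ℚ.+-*-rawSemiring using (_^_)

private variable
  ds : List ℕ

-- Rationals and integers

square-nonNeg : ∀ p → 0ℚ ℚ.≤ p ℚ.* p
square-nonNeg p with ℚ.≤-total 0ℚ p
... | inj₁ 0≤p = ℚ.nonNegative⁻¹ _
      {{ℚ.nonNeg*nonNeg⇒nonNeg p {{ℚ.nonNegative 0≤p}} p {{ℚ.nonNegative 0≤p}}}}
... | inj₂ p≤0 = ℚ.nonNegative⁻¹ _
      {{ℚ.nonPos*nonPos⇒nonPos p {{ℚ.nonPositive p≤0}} p {{ℚ.nonPositive p≤0}}}}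

nonZero*q≡0⇒q≡0 : ∀ p q .{{_ : ℚ.NonZero p}} → p ℚ.* q ≡ 0ℚ → q ≡ 0ℚ
nonZero*q≡0⇒q≡0 p q pq≡0 = begin
  q                       ≡⟨ ℚ.*-identityˡ q ⟨
  1ℚ ℚ.* q                ≡⟨ cong (ℚ._* q) (ℚ.*-inverseˡ p) ⟨
  ℚ.1/ p ℚ.* p ℚ.* q      ≡⟨ ℚ.*-assoc (ℚ.1/ p) p q ⟩
  ℚ.1/ p ℚ.* (p ℚ.* q)    ≡⟨ cong (ℚ.1/ p ℚ.*_) pq≡0 ⟩
  ℚ.1/ p ℚ.* 0ℚ           ≡⟨ ℚ.*-zeroʳ (ℚ.1/ p) ⟩
  0ℚ                      ∎
  where open ≡-Reasoning

square≡0⇒≡0 : ∀ p → p ℚ.* p ≡ 0ℚ → p ≡ 0ℚ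
square≡0⇒≡0 p pp≡0 with p ℚ.≟ 0ℚ
... | yes p≡0 = p≡0
... | no  p≢0 = nonZero*q≡0⇒q≡0 p p {{ℚ.≢-nonZero p≢0}} pp≡0

nonNeg+nonNeg≡0⇒≡0 : ∀ {p q} → 0ℚ ℚ.≤ p → 0ℚ ℚ.≤ q → p ℚ.+ q ≡ 0ℚ → p ≡ 0ℚ
nonNeg+nonNeg≡0⇒≡0 {p} {q} 0≤p 0≤q p+q≡0 = ℚ.≤-antisym
  (subst₂ ℚ._≤_ (ℚ.+-identityʳ p) p+q≡0 (ℚ.+-monoʳ-≤ p 0≤q)) 0≤p

fromℕ-nonNeg : ∀ n → 0ℚ ℚ.≤ fromℕ n
fromℕ-nonNeg n = ℚ.nonNegative⁻¹ _ {{ℚ.normalize-nonNeg n 1}}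

fromℕ-nonZero : ∀ n → ℚ.NonZero (fromℕ (suc n))
fromℕ-nonZero n = ℚ.pos⇒nonZero (fromℕ (suc n)) {{ℚ.normalize-pos (suc n) 1}}

fromℤ : ℤ → ℚ
fromℤ i = i ℚ./ 1

IsInteger : ℚ → Set
IsInteger q = Σ ℤ λ i → q ≡ fromℤ i

private
  toℚᵘ-fromℤ : ∀ i → ℚ.toℚᵘ (fromℤ i) ℚᵘ.≃ ℚᵘ.mkℚᵘ i 0
  toℚᵘ-fromℤ i = ℚ.toℚᵘ-fromℚᵘ (ℚᵘ.mkℚᵘ i 0)

fromℤ-+ : ∀ i j → fromℤ (i ℤ.+ j) ≡ fromℤ i ℚ.+ fromℤ j
fromℤ-+ i j = ℚ.toℚᵘ-injective (ℚᵘ.≃-trans (toℚᵘ-fromℤ (i ℤ.+ j)) (ℚᵘ.≃-sym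
  (ℚᵘ.≃-trans (ℚ.toℚᵘ-homo-+ (fromℤ i) (fromℤ j))
  (ℚᵘ.≃-trans (ℚᵘ.+-cong (toℚᵘ-fromℤ i) (toℚᵘ-fromℤ j))
  (ℚᵘ.*≡* (cong (ℤ._* + 1) (cong₂ ℤ._+_ (ℤ.*-identityʳ i) (ℤ.*-identityʳ j))))))))

fromℤ-* : ∀ i j → fromℤ (i ℤ.* j) ≡ fromℤ i ℚ.* fromℤ j
fromℤ-* i j = ℚ.toℚᵘ-injective (ℚᵘ.≃-trans (toℚᵘ-fromℤ (i ℤ.* j)) (ℚᵘ.≃-sym
  (ℚᵘ.≃-trans (ℚ.toℚᵘ-homo-* (fromℤ i) (fromℤ j))
  (ℚᵘ.≃-trans (ℚᵘ.*-cong (toℚᵘ-fromℤ i) (toℚᵘ-fromℤ j)) (ℚᵘ.*≡* refl)))))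

fromℤ-neg : ∀ i → fromℤ (ℤ.- i) ≡ ℚ.- fromℤ i
fromℤ-neg i = ℚ.toℚᵘ-injective (ℚᵘ.≃-trans (toℚᵘ-fromℤ (ℤ.- i)) (ℚᵘ.≃-sym
  (ℚᵘ.≃-trans (ℚ.toℚᵘ-homo‿- (fromℤ i)) (ℚᵘ.-‿cong (toℚᵘ-fromℤ i)))))

fromℤ-injective : ∀ {i j} → fromℤ i ≡ fromℤ j → i ≡ j
fromℤ-injective {i} {j} eq
  with ℚᵘ.≃-trans (ℚᵘ.≃-sym (toℚᵘ-fromℤ i)) (ℚᵘ.≃-trans (ℚᵘ.≃-reflexive (cong ℚ.toℚᵘ eq)) (toℚᵘ-fromℤ j))
... | ℚᵘ.*≡* i*1≡j*1 = trans (sym (ℤ.*-identityʳ i)) (trans i*1≡j*1 (ℤ.*-identityʳ j))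

fromℤ-^ : ∀ i k → fromℤ (i ℤ.^ k) ≡ fromℤ i ^ k
fromℤ-^ i zero    = refl
fromℤ-^ i (suc k) = trans (fromℤ-* i (i ℤ.^ k)) (cong (fromℤ i ℚ.*_) (fromℤ-^ i k))

fromℕ-* : ∀ m n → fromℕ (m ℕ.* n) ≡ fromℕ m ℚ.* fromℕ n
fromℕ-* m n = trans (cong fromℤ (ℤ.pos-* m n)) (fromℤ-* (+ m) (+ n))

↧*≡↥ : ∀ q → fromℤ (ℚ.↧ q) ℚ.* q ≡ fromℤ (ℚ.↥ q)
↧*≡↥ q@(mkℚ n d-1 _) = ℚ.toℚᵘ-injective
  (ℚᵘ.≃-trans (ℚ.toℚᵘ-homo-* (fromℤ (ℚ.↧ q)) q)
  (ℚᵘ.≃-trans (ℚᵘ.*-congʳ (toℚᵘ-fromℤ (ℚ.↧ q)))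
  (ℚᵘ.≃-trans (ℚᵘ.*≡* d*n*1≡n*d) (ℚᵘ.≃-sym (toℚᵘ-fromℤ n)))))
  where
  d*n*1≡n*d : (+ suc d-1 ℤ.* n) ℤ.* + 1 ≡ n ℤ.* + suc (d-1 ℕ.+ 0)
  d*n*1≡n*d = trans (ℤ.*-identityʳ _) (trans (ℤ.*-comm (+ suc d-1) n)
                    (cong (λ m → n ℤ.* + suc m) (sym (ℕ.+-identityʳ d-1))))

isInteger-+ : ∀ {p q} → IsInteger p → IsInteger q → IsInteger (p ℚ.+ q)
isInteger-+ (i , refl) (j , refl) = i ℤ.+ j , sym (fromℤ-+ i j)

isInteger-* : ∀ {p q} → IsInteger p → IsInteger q → IsInteger (p ℚ.* q)
isInteger-* (i , refl) (j , refl) = i ℤ.* j , sym (fromℤ-* i j)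

isInteger-neg : ∀ {p} → IsInteger p → IsInteger (ℚ.- p)
isInteger-neg (i , refl) = ℤ.- i , sym (fromℤ-neg i)

abs-^ : ∀ i k → ∣ i ℤ.^ k ∣ ≡ ∣ i ∣ ℕ.^ k
abs-^ i zero    = refl
abs-^ i (suc k) = trans (ℤ.abs-* i (i ℤ.^ k)) (cong (∣ i ∣ ℕ.*_) (abs-^ i k))

coprime-*ˡ : ∀ {m n o} → Coprime m o → Coprime n o → Coprime (m ℕ.* n) o
coprime-*ˡ {m} {n} {o} m⊥o n⊥o {e} (e∣mn , e∣o) = m⊥o (e∣m , e∣o)
  where
  e⊥n : Coprime e n
  e⊥n (f∣e , f∣n) = n⊥o (f∣n , ∣-trans f∣e e∣o)
  e∣m : e ∣ m
  e∣m = coprime-divisor e⊥n (subst (e ∣_) (ℕ.*-comm m n) e∣mn)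

coprime-^ˡ : ∀ {m n} → Coprime m n → ∀ k → Coprime (m ℕ.^ k) n
coprime-^ˡ m⊥n zero    (f∣1 , _) = ∣1⇒≡1 f∣1
coprime-^ˡ m⊥n (suc k) = coprime-*ˡ m⊥n (coprime-^ˡ m⊥n k)

n<2^n : ∀ n → n < 2 ℕ.^ n
n<2^n zero    = s≤s z≤n
n<2^n (suc n) = ℕ.+-mono-≤-< (ℕ.^-monoʳ-≤ 2 (z≤n {n})) (subst (n <_) (sym (ℕ.+-identityʳ _)) (n<2^n n))

-- By coprimality dᵏ ∣ C for every k, while 2ᵏ outgrows C.
powers-divide⇒≤1 : ∀ {a d} C → Coprime a d → (∀ k → d ℕ.^ k ∣ suc C ℕ.* a ℕ.^ k) → d ℕ.≤ 1
powers-divide⇒≤1 {a} {zero}          C _   _ = z≤n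
powers-divide⇒≤1 {a} {suc zero}      C _   _ = s≤s z≤n
powers-divide⇒≤1 {a} {suc (suc d-2)} C a⊥d h = ⊥-elim (ℕ.<-irrefl refl (begin-strict
  suc C               <⟨ n<2^n (suc C) ⟩
  2 ℕ.^ suc C         ≤⟨ ℕ.^-monoˡ-≤ (suc C) (s≤s (s≤s z≤n)) ⟩
  d ℕ.^ suc C         ≤⟨ ∣⇒≤ dᵏ∣C ⟩
  suc C               ∎))
  where
  open ℕ.≤-Reasoning
  d = suc (suc d-2)
  dᵏ∣C : d ℕ.^ suc C ∣ suc C
  dᵏ∣C = coprime-divisor (coprime-^ˡ (Coprimality.sym (coprime-^ˡ a⊥d (suc C))) (suc C))
           (subst (d ℕ.^ suc C ∣_) (ℕ.*-comm (suc C) _) (h (suc C)))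

cross-multiply-^ : ∀ C s k z → fromℕ C ℚ.* s ^ k ≡ fromℤ z →
                   + C ℤ.* ℚ.↥ s ℤ.^ k ≡ z ℤ.* ℚ.↧ s ℤ.^ k
cross-multiply-^ C s k z Csᵏ≡z = fromℤ-injective {+ C ℤ.* ℚ.↥ s ℤ.^ k} {z ℤ.* ℚ.↧ s ℤ.^ k} (begin
  fromℤ (+ C ℤ.* ℚ.↥ s ℤ.^ k)                ≡⟨ fromℤ-* (+ C) (ℚ.↥ s ℤ.^ k) ⟩
  fromℕ C ℚ.* fromℤ (ℚ.↥ s ℤ.^ k)            ≡⟨ cong (fromℕ C ℚ.*_) (fromℤ-^ (ℚ.↥ s) k) ⟩
  fromℕ C ℚ.* fromℤ (ℚ.↥ s) ^ k              ≡⟨ cong (λ t → fromℕ C ℚ.* t ^ k) (↧*≡↥ s) ⟨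
  fromℕ C ℚ.* (D ℚ.* s) ^ k                  ≡⟨ cong (fromℕ C ℚ.*_) (^-distrib-* D s k) ⟩
  fromℕ C ℚ.* (D ^ k ℚ.* s ^ k)              ≡⟨ x∙yz≈y∙xz (fromℕ C) (D ^ k) (s ^ k) ⟩
  D ^ k ℚ.* (fromℕ C ℚ.* s ^ k)              ≡⟨ cong (D ^ k ℚ.*_) Csᵏ≡z ⟩
  D ^ k ℚ.* fromℤ z                          ≡⟨ ℚ.*-comm _ (fromℤ z) ⟩
  fromℤ z ℚ.* D ^ k                          ≡⟨ cong (fromℤ z ℚ.*_) (fromℤ-^ (ℚ.↧ s) k) ⟨
  fromℤ z ℚ.* fromℤ (ℚ.↧ s ℤ.^ k)            ≡⟨ fromℤ-* z (ℚ.↧ s ℤ.^ k) ⟨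
  fromℤ (z ℤ.* ℚ.↧ s ℤ.^ k)                  ∎)
  where
  open ≡-Reasoning
  open CommutativeSemiringExp (CommutativeRing.commutativeSemiring ℚ.+-*-commutativeRing) using (^-distrib-*)
  open CommutativeSemigroupProperties (CommutativeMonoid.commutativeSemigroup ℚ.*-1-commutativeMonoid)
    using (x∙yz≈y∙xz)
  D = fromℤ (ℚ.↧ s)

bounded-powers⇒isInteger : ∀ C s → (∀ k → IsInteger (fromℕ (suc C) ℚ.* s ^ k)) → IsInteger s
bounded-powers⇒isInteger C s@(mkℚ n zero _)        _ = n , sym (ℚ.↥p/↧p≡p s)
bounded-powers⇒isInteger C s@(mkℚ n (suc d-2) n⊥d) h =
  ⊥-elim (ℕ.≤⇒≯ (powers-divide⇒≤1 C (Coprimality.recompute n⊥d) dᵏ∣Cnᵏ) (s≤s (s≤s z≤n)))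
  where
  d = suc (suc d-2)
  dᵏ∣Cnᵏ : ∀ k → d ℕ.^ k ∣ suc C ℕ.* ∣ n ∣ ℕ.^ k
  dᵏ∣Cnᵏ k with h k
  ... | z , Csᵏ≡z = divides ∣ z ∣ (begin
    suc C ℕ.* ∣ n ∣ ℕ.^ k          ≡⟨ cong (suc C ℕ.*_) (abs-^ n k) ⟨
    suc C ℕ.* ∣ n ℤ.^ k ∣          ≡⟨ ℤ.abs-* (+ suc C) (n ℤ.^ k) ⟨
    ∣ + suc C ℤ.* n ℤ.^ k ∣        ≡⟨ cong ∣_∣ (cross-multiply-^ (suc C) s k z Csᵏ≡z) ⟩
    ∣ z ℤ.* (+ d) ℤ.^ k ∣          ≡⟨ ℤ.abs-* z _ ⟩
    ∣ z ∣ ℕ.* ∣ (+ d) ℤ.^ k ∣      ≡⟨ cong (∣ z ∣ ℕ.*_) (abs-^ (+ d) k) ⟩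
    ∣ z ∣ ℕ.* d ℕ.^ k              ∎)
    where open ≡-Reasoning

-- ℚ-algebras with a parity automorphism and a transpose anti-automorphism

record IsInvolutiveℚAlgebra {A : Set} (_+_ _*_ : Op₂ A) (-_ : Op₁ A) (sc : ℚ → A)
                            (parity star : Op₁ A) : Set where
  field
    isRing            : IsRing _≡_ _+_ _*_ -_ (sc 0ℚ) (sc 1ℚ)
    sc-+              : ∀ p q → sc (p ℚ.+ q) ≡ sc p + sc q
    sc-*              : ∀ p q → sc (p ℚ.* q) ≡ sc p * sc q
    sc-central        : ∀ p x → sc p * x ≡ x * sc p
    parity-sc         : ∀ p → parity (sc p) ≡ sc p
    parity-+          : ∀ x y → parity (x + y) ≡ parity x + parity y
    parity-*          : ∀ x y → parity (x * y) ≡ parity x * parity y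
    parity-involutive : ∀ x → parity (parity x) ≡ x
    star-sc           : ∀ p → star (sc p) ≡ sc p
    star-+            : ∀ x y → star (x + y) ≡ star x + star y
    star-*            : ∀ x y → star (x * y) ≡ star y * star x
    star-involutive   : ∀ x → star (star x) ≡ x
    star-parity       : ∀ x → star (parity x) ≡ parity (star x)

  ring : Ring 0ℓ 0ℓ
  ring = record { Carrier = A ; _≈_ = _≡_ ; _+_ = _+_ ; _*_ = _*_ ; -_ = -_
                ; 0# = sc 0ℚ ; 1# = sc 1ℚ ; isRing = isRing }

  open Ring ring public
    using ( +-assoc; +-comm; +-identityˡ; +-identityʳ; -‿inverseˡ; -‿inverseʳ
          ; *-assoc; *-identityˡ; *-identityʳ; distribˡ; distribʳ; zeroˡ; zeroʳ
          ; _-_; +-commutativeSemigroup)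
  open RingProperties ring public
  open CommutativeSemigroupProperties +-commutativeSemigroup public
    using () renaming (interchange to +-interchange; x∙yz≈y∙xz to x+[y+z]≡y+[x+z])

  private
    additive⇒-‿homo : (f : Op₁ A) → f (sc 0ℚ) ≡ sc 0ℚ →
                      (∀ x y → f (x + y) ≡ f x + f y) → ∀ x → f (- x) ≡ - f x
    additive⇒-‿homo f f0≡0 f-+ x = +-inverseʳ-unique (f x) (f (- x))
      (trans (sym (f-+ x (- x))) (trans (cong f (-‿inverseʳ x)) f0≡0))

  sc-neg : ∀ p → sc (ℚ.- p) ≡ - sc p
  sc-neg p = +-inverseʳ-unique (sc p) (sc (ℚ.- p))
    (trans (sym (sc-+ p (ℚ.- p))) (cong sc (ℚ.+-inverseʳ p)))

  parity-neg : ∀ x → parity (- x) ≡ - parity x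
  parity-neg = additive⇒-‿homo parity (parity-sc 0ℚ) parity-+

  star-neg : ∀ x → star (- x) ≡ - star x
  star-neg = additive⇒-‿homo star (star-sc 0ℚ) star-+

  neg*neg : ∀ x y → (- x) * (- y) ≡ x * y
  neg*neg x y = trans (sym (-‿distribˡ-* x (- y)))
                      (trans (cong -_ (sym (-‿distribʳ-* x y))) (-‿involutive (x * y)))

  [w+y]-[x+z]≡[w-x]+[y-z] : ∀ w x y z → (w + y) - (x + z) ≡ (w - x) + (y - z)
  [w+y]-[x+z]≡[w-x]+[y-z] w x y z =
    trans (cong (λ t → (w + y) + t) (sym (-‿+-comm x z))) (+-interchange w y (- x) (- z))

  [x+y]-[x+z]≡y-z : ∀ x y z → (x + y) - (x + z) ≡ y - z
  [x+y]-[x+z]≡y-z x y z = trans ([w+y]-[x+z]≡[w-x]+[y-z] x x y z)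
    (trans (cong (_+ (y - z)) (-‿inverseʳ x)) (+-identityˡ (y - z)))

  [w-x]-[y+z]≡[w-y]-[z+x] : ∀ w x y z → (w - x) - (y + z) ≡ (w - y) - (z + x)
  [w-x]-[y+z]≡[w-y]-[z+x] w x y z = begin
    (w - x) - (y + z)          ≡⟨ +-assoc w (- x) _ ⟩
    w + ((- x) - (y + z))      ≡⟨ cong (λ t → w + t) (-‿+-comm x (y + z)) ⟩
    w + (- (x + (y + z)))      ≡⟨ cong (λ t → w + (- t)) (x∙yz≈y∙zx x y z) ⟩
    w + (- (y + (z + x)))      ≡⟨ cong (λ t → w + t) (-‿+-comm y (z + x)) ⟨
    w + ((- y) - (z + x))      ≡⟨ +-assoc w (- y) _ ⟨
    (w - y) - (z + x)          ∎
    where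
    open ≡-Reasoning
    open CommutativeSemigroupProperties +-commutativeSemigroup using (x∙yz≈y∙zx)

  [w-x]+[y+z]≡[w+y]+[z-x] : ∀ w x y z → (w - x) + (y + z) ≡ (w + y) + (z - x)
  [w-x]+[y+z]≡[w+y]+[z-x] w x y z =
    trans (+-interchange w (- x) y z) (cong (λ t → (w + y) + t) (+-comm (- x) z))

  x-z≡x : ∀ {x z} → z ≡ sc 0ℚ → x - z ≡ x
  x-z≡x {x} refl = trans (cong (λ t → x + t) -0#≈0#) (+-identityʳ x)

  z+x≡x : ∀ {x z} → z ≡ sc 0ℚ → z + x ≡ x
  z+x≡x {x} refl = +-identityˡ x

  x+z≡x : ∀ {x z} → z ≡ sc 0ℚ → x + z ≡ x
  x+z≡x {x} refl = +-identityʳ x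

-- (a , b) stands for a + bγ with γ² = -δ and γ a = (parity a) γ. The operations are literally
-- those of Defs, so that Cl (δ ∷ ds) is definitionally the doubling of Cl ds.
module Doubling {A : Set} {add mul : Op₂ A} {neg : Op₁ A} {sc : ℚ → A} {parity star : Op₁ A}
                (alg : IsInvolutiveℚAlgebra add mul neg sc parity star) (δ : ℕ) where

  open IsInvolutiveℚAlgebra alg
  open Ring ring using (_+_; _*_; -_; 0#)
  open ≡-Reasoning

  Δ : A
  Δ = sc (fromℕ δ)

  infixl 6 _⊕_
  infixl 7 _⊛_

  _⊕_ _⊛_ : Op₂ (A × A)
  (a , b) ⊕ (c , e) = a + c , b + e
  (a , b) ⊛ (c , e) = (a * c) - (Δ * (b * parity e)) , (a * e) + (b * parity c)

  ⊝_ parity₂ star₂ : Op₁ (A × A)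
  ⊝ (a , b)       = - a , - b
  parity₂ (a , b) = parity a , - parity b
  star₂ (a , b)   = star a , parity (star b)

  sc₂ : ℚ → A × A
  sc₂ p = sc p , 0#

  Δ-commute : ∀ x y → x * (Δ * y) ≡ Δ * (x * y)
  Δ-commute x y = trans (sym (*-assoc x Δ y))
                        (trans (cong (_* y) (sym (sc-central _ x))) (*-assoc Δ x y))

  Δ*[0*y]≡0 : ∀ y → Δ * (0# * y) ≡ 0#
  Δ*[0*y]≡0 y = trans (cong (Δ *_) (zeroˡ y)) (zeroʳ Δ)

  Δ*[y*parity0]≡0 : ∀ y → Δ * (y * parity 0#) ≡ 0#
  Δ*[y*parity0]≡0 y = trans (cong (λ t → Δ * (y * t)) (parity-sc 0ℚ)) (trans (cong (Δ *_) (zeroʳ y)) (zeroʳ Δ))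

  ⊛-assoc₁ : ∀ a b c e f g →
    ((a * c) - Δ * (b * parity e)) * f - Δ * (((a * e) + b * parity c) * parity g)
    ≡ a * ((c * f) - Δ * (e * parity g)) - Δ * (b * parity ((c * g) + e * parity f))
  ⊛-assoc₁ a b c e f g = begin
    ((a * c) - Δ * (b * parity e)) * f - Δ * (((a * e) + b * parity c) * parity g)
      ≡⟨ cong₂ _-_ ([y-z]x≈yx-zx f _ _) (trans (cong (Δ *_) (distribʳ _ _ _)) (distribˡ Δ _ _)) ⟩
    ((a * c) * f - (Δ * (b * parity e)) * f) - (Δ * ((a * e) * parity g) + Δ * ((b * parity c) * parity g))
      ≡⟨ cong₂ (λ u v → (u - v) - (Δ * ((a * e) * parity g) + Δ * ((b * parity c) * parity g)))
               (*-assoc a c f) (trans (*-assoc Δ _ f) (cong (Δ *_) (*-assoc b _ f))) ⟩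
    (a * (c * f) - Δ * (b * (parity e * f))) - (Δ * ((a * e) * parity g) + Δ * ((b * parity c) * parity g))
      ≡⟨ cong₂ (λ u v → (a * (c * f) - Δ * (b * (parity e * f))) - (Δ * u + Δ * v)) (*-assoc a e _) (*-assoc b _ _) ⟩
    (a * (c * f) - Δ * (b * (parity e * f))) - (Δ * (a * (e * parity g)) + Δ * (b * (parity c * parity g)))
      ≡⟨ [w-x]-[y+z]≡[w-y]-[z+x] _ _ _ _ ⟩
    (a * (c * f) - Δ * (a * (e * parity g))) - (Δ * (b * (parity c * parity g)) + Δ * (b * (parity e * f)))
      ≡⟨ cong₂ (λ u v → (a * (c * f) - u) - (Δ * (b * (parity c * parity g)) + Δ * (b * (parity e * v))))
               (sym (Δ-commute a _)) (sym (parity-involutive f)) ⟩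
    (a * (c * f) - a * (Δ * (e * parity g))) - (Δ * (b * (parity c * parity g)) + Δ * (b * (parity e * parity (parity f))))
      ≡⟨ cong₂ _-_ (sym (x[y-z]≈xy-xz a _ _)) (trans (sym (distribˡ Δ _ _)) (cong (Δ *_) (sym (distribˡ b _ _)))) ⟩
    a * ((c * f) - Δ * (e * parity g)) - Δ * (b * (parity c * parity g + parity e * parity (parity f)))
      ≡⟨ cong (λ t → a * ((c * f) - Δ * (e * parity g)) - Δ * (b * t))
              (sym (trans (parity-+ _ _) (cong₂ _+_ (parity-* c g) (parity-* e _)))) ⟩
    a * ((c * f) - Δ * (e * parity g)) - Δ * (b * parity ((c * g) + e * parity f)) ∎

  ⊛-assoc₂ : ∀ a b c e f g →
    ((a * c) - Δ * (b * parity e)) * g + ((a * e) + b * parity c) * parity f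
    ≡ a * ((c * g) + e * parity f) + b * parity ((c * f) - Δ * (e * parity g))
  ⊛-assoc₂ a b c e f g = begin
    ((a * c) - Δ * (b * parity e)) * g + ((a * e) + b * parity c) * parity f
      ≡⟨ cong₂ _+_ ([y-z]x≈yx-zx g _ _) (distribʳ _ _ _) ⟩
    ((a * c) * g - (Δ * (b * parity e)) * g) + ((a * e) * parity f + (b * parity c) * parity f)
      ≡⟨ cong₂ (λ u v → (u - v) + ((a * e) * parity f + (b * parity c) * parity f))
               (*-assoc a c g) (trans (*-assoc Δ _ g) (cong (Δ *_) (*-assoc b _ g))) ⟩
    (a * (c * g) - Δ * (b * (parity e * g))) + ((a * e) * parity f + (b * parity c) * parity f)
      ≡⟨ cong₂ (λ u v → (a * (c * g) - Δ * (b * (parity e * g))) + (u + v)) (*-assoc a e _) (*-assoc b _ _) ⟩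
    (a * (c * g) - Δ * (b * (parity e * g))) + (a * (e * parity f) + b * (parity c * parity f))
      ≡⟨ [w-x]+[y+z]≡[w+y]+[z-x] _ _ _ _ ⟩
    (a * (c * g) + a * (e * parity f)) + (b * (parity c * parity f) - Δ * (b * (parity e * g)))
      ≡⟨ cong (λ v → (a * (c * g) + a * (e * parity f)) + (b * (parity c * parity f) - Δ * (b * (parity e * v))))
              (sym (parity-involutive g)) ⟩
    (a * (c * g) + a * (e * parity f)) + (b * (parity c * parity f) - Δ * (b * (parity e * parity (parity g))))
      ≡⟨ cong₂ _+_ (sym (distribˡ a _ _))
               (trans (cong (λ t → b * (parity c * parity f) - t) (sym (Δ-commute b _))) (sym (x[y-z]≈xy-xz b _ _))) ⟩
    a * ((c * g) + e * parity f) + b * (parity c * parity f - Δ * (parity e * parity (parity g)))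
      ≡⟨ cong (λ t → a * ((c * g) + e * parity f) + b * t) (sym parity-difference) ⟩
    a * ((c * g) + e * parity f) + b * parity ((c * f) - Δ * (e * parity g)) ∎
    where
    parity-difference : parity ((c * f) - Δ * (e * parity g)) ≡ parity c * parity f - Δ * (parity e * parity (parity g))
    parity-difference = trans (parity-+ _ _) (cong₂ _+_ (parity-* c f)
      (trans (parity-neg _) (cong -_ (trans (parity-* Δ _) (cong₂ _*_ (parity-sc _) (parity-* e _))))))

  ⊛-assoc : ∀ x y z → (x ⊛ y) ⊛ z ≡ x ⊛ (y ⊛ z)
  ⊛-assoc (a , b) (c , e) (f , g) = cong₂ _,_ (⊛-assoc₁ a b c e f g) (⊛-assoc₂ a b c e f g)

  ⊛-identityˡ : ∀ x → sc₂ 1ℚ ⊛ x ≡ x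
  ⊛-identityˡ (a , b) = cong₂ _,_ (trans (x-z≡x (Δ*[0*y]≡0 _)) (*-identityˡ a))
                                  (trans (x+z≡x (zeroˡ _)) (*-identityˡ b))

  ⊛-identityʳ : ∀ x → x ⊛ sc₂ 1ℚ ≡ x
  ⊛-identityʳ (a , b) = cong₂ _,_ (trans (x-z≡x (Δ*[y*parity0]≡0 b)) (*-identityʳ a))
    (trans (z+x≡x (zeroʳ a)) (trans (cong (b *_) (parity-sc 1ℚ)) (*-identityʳ b)))

  ⊛-distribˡ : ∀ x y z → x ⊛ (y ⊕ z) ≡ (x ⊛ y) ⊕ (x ⊛ z)
  ⊛-distribˡ (a , b) (c , e) (f , g) = cong₂ _,_
    (trans (cong₂ _-_ (distribˡ a c f)
             (trans (cong (λ t → Δ * (b * t)) (parity-+ e g))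
                    (trans (cong (Δ *_) (distribˡ b _ _)) (distribˡ Δ _ _))))
           ([w+y]-[x+z]≡[w-x]+[y-z] _ _ _ _))
    (trans (cong₂ _+_ (distribˡ a e g) (trans (cong (b *_) (parity-+ c f)) (distribˡ b _ _)))
           (+-interchange _ _ _ _))

  ⊛-distribʳ : ∀ x y z → (y ⊕ z) ⊛ x ≡ (y ⊛ x) ⊕ (z ⊛ x)
  ⊛-distribʳ (a , b) (c , e) (f , g) = cong₂ _,_
    (trans (cong₂ _-_ (distribʳ a c f) (trans (cong (Δ *_) (distribʳ (parity b) e g)) (distribˡ Δ _ _)))
           ([w+y]-[x+z]≡[w-x]+[y-z] _ _ _ _))
    (trans (cong₂ _+_ (distribʳ b c f) (distribʳ (parity a) e g)) (+-interchange _ _ _ _))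

  isRing₂ : IsRing _≡_ _⊕_ _⊛_ ⊝_ (sc₂ 0ℚ) (sc₂ 1ℚ)
  isRing₂ = record
    { +-isAbelianGroup = record
      { isGroup = record
        { isMonoid = record
          { isSemigroup = record
            { isMagma = record { isEquivalence = isEquivalence ; ∙-cong = cong₂ _⊕_ }
            ; assoc   = λ (a , b) (c , e) (f , g) → cong₂ _,_ (+-assoc a c f) (+-assoc b e g) }
          ; identity = (λ (a , b) → cong₂ _,_ (+-identityˡ a) (+-identityˡ b))
                     , (λ (a , b) → cong₂ _,_ (+-identityʳ a) (+-identityʳ b)) }
        ; inverse = (λ (a , b) → cong₂ _,_ (-‿inverseˡ a) (-‿inverseˡ b))
                  , (λ (a , b) → cong₂ _,_ (-‿inverseʳ a) (-‿inverseʳ b))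
        ; ⁻¹-cong = cong ⊝_ }
      ; comm = λ (a , b) (c , e) → cong₂ _,_ (+-comm a c) (+-comm b e) }
    ; *-cong     = cong₂ _⊛_
    ; *-assoc    = ⊛-assoc
    ; *-identity = ⊛-identityˡ , ⊛-identityʳ
    ; distrib    = ⊛-distribˡ , ⊛-distribʳ }

  sc₂-⊛ : ∀ p a b → sc₂ p ⊛ (a , b) ≡ (sc p * a , sc p * b)
  sc₂-⊛ p a b = cong₂ _,_ (x-z≡x (Δ*[0*y]≡0 _)) (x+z≡x (zeroˡ _))

  sc₂-* : ∀ p q → sc₂ (p ℚ.* q) ≡ sc₂ p ⊛ sc₂ q
  sc₂-* p q = trans (cong₂ _,_ (sc-* p q) (sym (zeroʳ (sc p)))) (sym (sc₂-⊛ p (sc q) 0#))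

  sc₂-central : ∀ p x → sc₂ p ⊛ x ≡ x ⊛ sc₂ p
  sc₂-central p (a , b) = trans (sc₂-⊛ p a b) (cong₂ _,_
    (trans (sc-central p a) (sym (x-z≡x (Δ*[y*parity0]≡0 b))))
    (trans (sc-central p b) (sym (trans (z+x≡x (zeroʳ a)) (cong (b *_) (parity-sc p))))))

  parity₂-* : ∀ x y → parity₂ (x ⊛ y) ≡ parity₂ x ⊛ parity₂ y
  parity₂-* (a , b) (c , e) = cong₂ _,_
    (trans (parity-+ _ _) (cong₂ _+_ (parity-* a c)
      (trans (parity-neg _) (cong -_ (trans (parity-* Δ _) (cong₂ _*_ (parity-sc _)
        (trans (parity-* b _) (sym (trans (cong (- parity b *_) (parity-neg _)) (neg*neg _ _))))))))))
    (trans (cong -_ (trans (parity-+ _ _) (cong₂ _+_ (parity-* a e) (parity-* b _))))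
      (trans (sym (-‿+-comm _ _)) (cong₂ _+_ (-‿distribʳ-* _ _) (-‿distribˡ-* _ _))))

  parity₂-involutive : ∀ x → parity₂ (parity₂ x) ≡ x
  parity₂-involutive (a , b) = cong₂ _,_ (parity-involutive a)
    (trans (cong -_ (parity-neg _)) (trans (-‿involutive _) (parity-involutive b)))

  star₂-* : ∀ x y → star₂ (x ⊛ y) ≡ star₂ y ⊛ star₂ x
  star₂-* (a , b) (c , e) = cong₂ _,_
    (trans (star-+ _ _) (cong₂ _+_ (star-* a c) (trans (star-neg _) (cong -_ star-Δterm))))
    (trans (cong parity (trans (star-+ _ _) (cong₂ _+_ (star-* a e) (star-* b _))))
      (trans (parity-+ _ _) (trans (cong₂ _+_ (parity-* _ _) (parity-* _ _))
        (trans (+-comm _ _) (cong (λ t → t * parity (star b) + parity (star e) * parity (star a))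
          (trans (cong parity (star-parity c)) (parity-involutive _)))))))
    where
    star-Δterm : star (Δ * (b * parity e)) ≡ Δ * (parity (star e) * parity (parity (star b)))
    star-Δterm = begin
      star (Δ * (b * parity e))                          ≡⟨ star-* Δ _ ⟩
      star (b * parity e) * star Δ                       ≡⟨ cong₂ _*_ (star-* b _) (star-sc _) ⟩
      (star (parity e) * star b) * Δ                     ≡⟨ sc-central _ _ ⟨
      Δ * (star (parity e) * star b)                     ≡⟨ cong₂ (λ u v → Δ * (u * v)) (star-parity e)
                                                                  (sym (parity-involutive _)) ⟩
      Δ * (parity (star e) * parity (parity (star b)))   ∎

  star₂-involutive : ∀ x → star₂ (star₂ x) ≡ x
  star₂-involutive (a , b) = cong₂ _,_ (star-involutive a)
    (trans (cong parity (star-parity _)) (trans (parity-involutive _) (star-involutive b)))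

  star₂-parity₂ : ∀ x → star₂ (parity₂ x) ≡ parity₂ (star₂ x)
  star₂-parity₂ (a , b) = cong₂ _,_ (star-parity a)
    (trans (cong parity (trans (star-neg _) (cong -_ (star-parity b)))) (parity-neg _))

  isInvolutiveℚAlgebra : IsInvolutiveℚAlgebra _⊕_ _⊛_ ⊝_ sc₂ parity₂ star₂
  isInvolutiveℚAlgebra = record
    { isRing            = isRing₂
    ; sc-+              = λ p q → cong₂ _,_ (sc-+ p q) (sym (+-identityˡ 0#))
    ; sc-*              = sc₂-*
    ; sc-central        = sc₂-central
    ; parity-sc         = λ p → cong₂ _,_ (parity-sc p) (trans (cong -_ (parity-sc 0ℚ)) -0#≈0#)
    ; parity-+          = λ (a , b) (c , e) →
                            cong₂ _,_ (parity-+ a c) (trans (cong -_ (parity-+ b e)) (sym (-‿+-comm _ _)))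
    ; parity-*          = parity₂-*
    ; parity-involutive = parity₂-involutive
    ; star-sc           = λ p → cong₂ _,_ (star-sc p) (trans (cong parity (star-sc 0ℚ)) (parity-sc 0ℚ))
    ; star-+            = λ (a , b) (c , e) →
                            cong₂ _,_ (star-+ a c) (trans (cong parity (star-+ b e)) (parity-+ _ _))
    ; star-*            = star₂-*
    ; star-involutive   = star₂-involutive
    ; star-parity       = star₂-parity₂
    }

ℚ-isInvolutiveℚAlgebra : IsInvolutiveℚAlgebra ℚ._+_ ℚ._*_ ℚ.-_ (λ p → p) (λ p → p) (λ p → p)
ℚ-isInvolutiveℚAlgebra = record
  { isRing = ℚ.+-*-isRing ; sc-+ = λ _ _ → refl ; sc-* = λ _ _ → refl ; sc-central = ℚ.*-comm
  ; parity-sc = λ _ → refl ; parity-+ = λ _ _ → refl ; parity-* = λ _ _ → refl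
  ; parity-involutive = λ _ → refl
  ; star-sc = λ _ → refl ; star-+ = λ _ _ → refl ; star-* = ℚ.*-comm
  ; star-involutive = λ _ → refl ; star-parity = λ _ → refl }

Cl-isInvolutiveℚAlgebra : ∀ ds → IsInvolutiveℚAlgebra (_+K_ {ds}) _*K_ -K_ sc parity star
Cl-isInvolutiveℚAlgebra []       = ℚ-isInvolutiveℚAlgebra
Cl-isInvolutiveℚAlgebra (δ ∷ ds) = Doubling.isInvolutiveℚAlgebra (Cl-isInvolutiveℚAlgebra ds) δ

module _ {ds : List ℕ} where
  open IsInvolutiveℚAlgebra (Cl-isInvolutiveℚAlgebra ds) public

-- The Clifford algebra: scalars, vectors and the norm form

conj-+ : ∀ (x y : Cl ds) → conj (x +K y) ≡ conj x +K conj y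
conj-+ x y = trans (cong star (parity-+ x y)) (star-+ _ _)

conj-* : ∀ (x y : Cl ds) → conj (x *K y) ≡ conj y *K conj x
conj-* x y = trans (cong star (parity-* x y)) (star-* _ _)

conj-neg : ∀ (x : Cl ds) → conj (-K x) ≡ -K conj x
conj-neg x = trans (cong star (parity-neg x)) (star-neg _)

conj-sc : ∀ p → conj (sc {ds} p) ≡ sc p
conj-sc p = trans (cong star (parity-sc p)) (star-sc p)

conj-involutive : ∀ (x : Cl ds) → conj (conj x) ≡ x
conj-involutive x = trans (star-parity _) (trans (cong parity (star-involutive _)) (parity-involutive x))

scalarPart-sc : ∀ p → scalarPart (sc {ds} p) ≡ p
scalarPart-sc {[]}     p = refl
scalarPart-sc {_ ∷ ds} p = scalarPart-sc {ds} p

≡sc⇒isScalar : ∀ {x : Cl ds} {p} → x ≡ sc p → IsScalar x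
≡sc⇒isScalar {ds} {p = p} refl = cong sc (sym (scalarPart-sc {ds} p))

isScalar-sc : ∀ p → IsScalar (sc {ds} p)
isScalar-sc p = ≡sc⇒isScalar refl

isScalar-+ : ∀ {x y : Cl ds} → IsScalar x → IsScalar y → IsScalar (x +K y)
isScalar-+ sx sy = ≡sc⇒isScalar (trans (cong₂ _+K_ sx sy) (sym (sc-+ _ _)))

isScalar-neg : ∀ {x : Cl ds} → IsScalar x → IsScalar (-K x)
isScalar-neg sx = ≡sc⇒isScalar (trans (cong -K_ sx) (sym (sc-neg _)))

isScalar-sc* : ∀ p {x : Cl ds} → IsScalar x → IsScalar (sc p *K x)
isScalar-sc* p sx = ≡sc⇒isScalar (trans (cong (sc p *K_) sx) (sym (sc-* _ _)))

isScalar-cancelˡ : ∀ {x y : Cl ds} → IsScalar x → IsScalar (x +K y) → IsScalar y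
isScalar-cancelˡ {x = x} {y} sx sxy =
  subst IsScalar (xyx⁻¹≈y x y) (isScalar-+ sxy (isScalar-neg sx))

isScalar-cancelʳ : ∀ {x y : Cl ds} → IsScalar y → IsScalar (x +K y) → IsScalar x
isScalar-cancelʳ {x = x} {y} sy sxy = isScalar-cancelˡ sy (subst IsScalar (+-comm x y) sxy)

sc-sandwich : ∀ p (a c : Cl ds) → a *K sc p *K c ≡ sc p *K (a *K c)
sc-sandwich p a c = trans (cong (_*K c) (sym (sc-central p a))) (*-assoc _ a c)

scalar-sandwich : ∀ {s : Cl ds} a c → IsScalar s → a *K s *K c ≡ sc (scalarPart s) *K (a *K c)
scalar-sandwich a c ss = trans (cong (λ t → a *K t *K c) ss) (sc-sandwich _ a c)

sc*-pair : ∀ δ p (a b : Cl ds) → _*K_ {δ ∷ ds} (sc {δ ∷ ds} p) (a , b) ≡ (sc p *K a , sc p *K b)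
sc*-pair {ds} = Doubling.sc₂-⊛ (Cl-isInvolutiveℚAlgebra ds)

isVec-sc : ∀ p → IsVec (sc {ds} p)
isVec-sc {[]}     p = tt
isVec-sc {_ ∷ ds} p = isVec-sc p , isScalar-sc 0ℚ

isVec-+ : ∀ {x y : Cl ds} → IsVec x → IsVec y → IsVec (x +K y)
isVec-+ {[]}                     _         _         = tt
isVec-+ {_ ∷ _} {_ , _} {_ , _} (va , sb) (vc , se) = isVec-+ va vc , isScalar-+ sb se

isVec-neg : ∀ {x : Cl ds} → IsVec x → IsVec (-K x)
isVec-neg {[]}             _         = tt
isVec-neg {_ ∷ _} {_ , _} (va , sb) = isVec-neg va , isScalar-neg sb

isVec-sc* : ∀ p {x : Cl ds} → IsVec x → IsVec (sc p *K x)
isVec-sc* {[]}     p             _         = tt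
isVec-sc* {δ ∷ ds} p {a , b} (va , sb) =
  subst (IsVec {δ ∷ ds}) (sym (sc*-pair δ p a b)) (isVec-sc* p va , isScalar-sc* p sb)

isVec-parity : ∀ {x : Cl ds} → IsVec x → IsVec (parity x)
isVec-parity {[]}             _         = tt
isVec-parity {_ ∷ _} {_ , _} (va , sb) =
  isVec-parity va , isScalar-neg (≡sc⇒isScalar (trans (cong parity sb) (parity-sc _)))

star-vec : ∀ {v : Cl ds} → IsVec v → star v ≡ v
star-vec {[]}             _         = refl
star-vec {_ ∷ _} {a , b} (va , sb) = cong₂ _,_ (star-vec va) (begin
  parity (star b)                  ≡⟨ cong (parity ∘ star) sb ⟩
  parity (star (sc (scalarPart b))) ≡⟨ trans (cong parity (star-sc _)) (parity-sc _) ⟩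
  sc (scalarPart b)                ≡⟨ sb ⟨
  b                                ∎)
  where open ≡-Reasoning

conj-vec : ∀ {v : Cl ds} → IsVec v → conj v ≡ parity v
conj-vec {v = v} vv = trans (star-parity v) (cong parity (star-vec vv))

isVec-conj : ∀ {v : Cl ds} → IsVec v → IsVec (conj v)
isVec-conj vv = subst IsVec (sym (conj-vec vv)) (isVec-parity vv)

_≟_ : DecidableEquality (Cl ds)
_≟_ {[]}     = ℚ._≟_
_≟_ {_ ∷ ds} = Product.≡-dec _≟_ _≟_

isVec-scalar* : ∀ {s u : Cl ds} → IsScalar s → IsVec u → IsVec (s *K u)
isVec-scalar* {u = u} ss vu = subst (λ t → IsVec (t *K u)) (sym ss) (isVec-sc* _ vu)

isVec-*scalar : ∀ {s u : Cl ds} → IsScalar s → IsVec u → IsVec (u *K s)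
isVec-*scalar {s = s} {u} ss vu =
  subst IsVec (trans (cong (_*K u) ss) (trans (sc-central _ u) (cong (u *K_) (sym ss)))) (isVec-scalar* ss vu)

-- Reads only the scalar part of the γ-coordinate: this is the norm form v v̄ on vectors, not a norm on K.
vecNorm : Cl ds → ℚ
vecNorm {[]}    x       = x ℚ.* x
vecNorm {δ ∷ _} (a , b) = vecNorm a ℚ.+ fromℕ δ ℚ.* (scalarPart b ℚ.* scalarPart b)

private
  0≤δs² : ∀ δ s → 0ℚ ℚ.≤ fromℕ δ ℚ.* (s ℚ.* s)
  0≤δs² δ s = ℚ.nonNegative⁻¹ _ {{ℚ.nonNeg*nonNeg⇒nonNeg (fromℕ δ) {{ℚ.nonNegative (fromℕ-nonNeg δ)}}
                                                          _ {{ℚ.nonNegative (square-nonNeg s)}}}}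

vecNorm-nonNeg : ∀ (v : Cl ds) → 0ℚ ℚ.≤ vecNorm v
vecNorm-nonNeg {[]}    x       = square-nonNeg x
vecNorm-nonNeg {δ ∷ _} (a , b) = ℚ.+-mono-≤ (vecNorm-nonNeg a) (0≤δs² δ (scalarPart b))

vecNorm≡0⇒≡0 : All (0 <_) ds → ∀ {v : Cl ds} → IsVec v → vecNorm v ≡ 0ℚ → v ≡ 0K
vecNorm≡0⇒≡0 []                        {x}     _         xx≡0 = square≡0⇒≡0 x xx≡0
vecNorm≡0⇒≡0 {suc k ∷ _} (_ ∷ δs>0) {a , b} (va , sb) N≡0 = cong₂ _,_
  (vecNorm≡0⇒≡0 δs>0 va (nonNeg+nonNeg≡0⇒≡0 (vecNorm-nonNeg a) (0≤δs² (suc k) s) N≡0))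
  (trans sb (cong sc (square≡0⇒≡0 s (nonZero*q≡0⇒q≡0 (fromℕ (suc k)) (s ℚ.* s) {{fromℕ-nonZero k}} δs²≡0))))
  where
  s = scalarPart b
  δs² = fromℕ (suc k) ℚ.* (s ℚ.* s)
  δs²≡0 : δs² ≡ 0ℚ
  δs²≡0 = nonNeg+nonNeg≡0⇒≡0 (0≤δs² (suc k) s) (vecNorm-nonNeg a) (trans (ℚ.+-comm δs² (vecNorm a)) N≡0)

vec*parity≡vecNorm : ∀ {v : Cl ds} → IsVec v → v *K parity v ≡ sc (vecNorm v)
vec*parity≡vecNorm {[]}               _         = refl
vec*parity≡vecNorm {δ ∷ _} {a , b} (va , sb) = cong₂ _,_ component₁ component₂
  where
  open ≡-Reasoning
  s = scalarPart b
  n = vecNorm a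
  Δ = sc (fromℕ δ)
  component₁ : a *K parity a -K Δ *K (b *K parity (-K parity b)) ≡ sc (n ℚ.+ fromℕ δ ℚ.* (s ℚ.* s))
  component₁ = begin
    a *K parity a -K Δ *K (b *K parity (-K parity b))
      ≡⟨ cong₂ (λ u t → u -K Δ *K (b *K t)) (vec*parity≡vecNorm va)
               (trans (parity-neg _) (cong -K_ (parity-involutive b))) ⟩
    sc n -K Δ *K (b *K (-K b))
      ≡⟨ cong (λ t → sc n -K t) (trans (cong (Δ *K_) (sym (-‿distribʳ-* b b))) (sym (-‿distribʳ-* Δ _))) ⟩
    sc n -K (-K (Δ *K (b *K b)))
      ≡⟨ cong (sc n +K_) (-‿involutive _) ⟩
    sc n +K Δ *K (b *K b)
      ≡⟨ cong (λ t → sc n +K Δ *K (t *K t)) sb ⟩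
    sc n +K Δ *K (sc s *K sc s)
      ≡⟨ trans (cong (λ t → sc n +K Δ *K t) (sym (sc-* s s))) (cong (sc n +K_) (sym (sc-* _ _))) ⟩
    sc n +K sc (fromℕ δ ℚ.* (s ℚ.* s))
      ≡⟨ sc-+ _ _ ⟨
    sc (n ℚ.+ fromℕ δ ℚ.* (s ℚ.* s)) ∎
  b-central : a *K b ≡ b *K a
  b-central = trans (cong (a *K_) sb) (trans (sym (sc-central s a)) (cong (_*K a) (sym sb)))
  component₂ : a *K (-K parity b) +K b *K parity (parity a) ≡ sc 0ℚ
  component₂ = begin
    a *K (-K parity b) +K b *K parity (parity a)
      ≡⟨ cong₂ (λ u t → a *K (-K u) +K b *K t) (trans (cong parity sb) (trans (parity-sc s) (sym sb)))
               (parity-involutive a) ⟩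
    a *K (-K b) +K b *K a
      ≡⟨ cong (_+K b *K a) (trans (sym (-‿distribʳ-* a b)) (cong -K_ b-central)) ⟩
    -K (b *K a) +K b *K a
      ≡⟨ -‿inverseˡ _ ⟩
    sc 0ℚ ∎

vec*conj≡vecNorm : ∀ {v : Cl ds} → IsVec v → v *K conj v ≡ sc (vecNorm v)
vec*conj≡vecNorm {v = v} vv = trans (cong (v *K_) (conj-vec vv)) (vec*parity≡vecNorm vv)

conj-vec*vec≡vecNorm : ∀ {v : Cl ds} → IsVec v → conj v *K v ≡ sc (vecNorm (conj v))
conj-vec*vec≡vecNorm {v = v} vv =
  trans (cong (conj v *K_) (sym (conj-involutive v))) (vec*conj≡vecNorm (isVec-conj vv))

vec-polarization : ∀ {v w : Cl ds} → IsVec v → IsVec w → IsScalar (v *K conj w +K w *K conj v)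
vec-polarization {ds} {v} {w} vv vw =
  isScalar-cancelʳ (norm-scalar vw) (isScalar-cancelˡ (norm-scalar vv)
    (subst IsScalar expand (norm-scalar (isVec-+ vv vw))))
  where
  norm-scalar : ∀ {u : Cl ds} → IsVec u → IsScalar (u *K conj u)
  norm-scalar vu = ≡sc⇒isScalar (vec*conj≡vecNorm vu)
  expand : (v +K w) *K conj (v +K w)
         ≡ v *K conj v +K ((v *K conj w +K w *K conj v) +K w *K conj w)
  expand = begin
    (v +K w) *K conj (v +K w)
      ≡⟨ trans (cong ((v +K w) *K_) (conj-+ v w)) (distribʳ _ v w) ⟩
    v *K (conj v +K conj w) +K w *K (conj v +K conj w)
      ≡⟨ cong₂ _+K_ (distribˡ v _ _) (distribˡ w _ _) ⟩
    (v *K conj v +K v *K conj w) +K (w *K conj v +K w *K conj w)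
      ≡⟨ +-assoc _ _ _ ⟩
    v *K conj v +K (v *K conj w +K (w *K conj v +K w *K conj w))
      ≡⟨ cong (v *K conj v +K_) (+-assoc _ _ _) ⟨
    v *K conj v +K ((v *K conj w +K w *K conj v) +K w *K conj w) ∎
    where open ≡-Reasoning

-- v u v = (v u + ū v̄) v - ū (v̄ v), and both brackets are scalars.
vec-sandwich : ∀ {v u : Cl ds} → IsVec v → IsVec u → IsVec (v *K u *K v)
vec-sandwich {v = v} {u} vv vu = subst IsVec (sym vuv≡) (isVec-+
  (isVec-scalar* (vec-polarization vv (isVec-conj vu)) vv)
  (isVec-neg (isVec-*scalar (≡sc⇒isScalar (conj-vec*vec≡vecNorm vv)) (isVec-conj vu))))
  where
  open ≡-Reasoning
  B = v *K conj (conj u) +K conj u *K conj v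
  Z = conj u *K (conj v *K v)
  B*v : B *K v ≡ v *K u *K v +K Z
  B*v = trans (distribʳ v _ _)
    (cong₂ _+K_ (cong (λ t → v *K t *K v) (conj-involutive u)) (*-assoc _ _ v))
  vuv≡ : v *K u *K v ≡ B *K v -K Z
  vuv≡ = begin
    v *K u *K v                 ≡⟨ xyx⁻¹≈y Z _ ⟨
    Z +K v *K u *K v -K Z       ≡⟨ cong (_-K Z) (+-comm Z _) ⟩
    v *K u *K v +K Z -K Z       ≡⟨ cong (_-K Z) B*v ⟨
    B *K v -K Z                 ∎

_IsInverseOf_ : Cl ds → Cl ds → Set
y IsInverseOf x = y *K x ≡ 1K × x *K y ≡ 1K

left-inverse≡right-inverse : ∀ {l x r : Cl ds} → l *K x ≡ 1K → x *K r ≡ 1K → l ≡ r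
left-inverse≡right-inverse {l = l} {x} {r} lx≡1 xr≡1 = begin
  l               ≡⟨ *-identityʳ l ⟨
  l *K 1K         ≡⟨ cong (l *K_) xr≡1 ⟨
  l *K (x *K r)   ≡⟨ *-assoc l x r ⟨
  l *K x *K r     ≡⟨ cong (_*K r) lx≡1 ⟩
  1K *K r         ≡⟨ *-identityˡ r ⟩
  r               ∎
  where open ≡-Reasoning

sc-commute : ∀ p (x y : Cl ds) → x *K (sc p *K y) ≡ sc p *K (x *K y)
sc-commute p x y = trans (sym (*-assoc x _ y)) (trans (cong (_*K y) (sym (sc-central p x))) (*-assoc _ x y))

sc-1/-cancel : ∀ {x : Cl ds} p .{{_ : ℚ.NonZero p}} → x ≡ sc p → sc (ℚ.1/ p) *K x ≡ 1K
sc-1/-cancel p refl = trans (sym (sc-* _ p)) (cong sc (ℚ.*-inverseˡ p))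

-- w̄ / (w w̄) is a right inverse; the left inverse built from the vector w̄ must agree with it.
vec-inverse : All (0 <_) ds → ∀ {w : Cl ds} → IsVec w → w ≢ 0K →
              Σ (Cl ds) λ w⁻¹ → IsVec w⁻¹ × w⁻¹ IsInverseOf w
vec-inverse δs>0 {w} vw w≢0 = r , isVec-sc* _ (isVec-conj vw) , r*w≡1 , w*r≡1
  where
  conj-w≢0 : conj w ≢ 0K
  conj-w≢0 e = w≢0 (trans (sym (conj-involutive w)) (trans (cong conj e) (conj-sc 0ℚ)))
  instance
    n≢0 : ℚ.NonZero (vecNorm w)
    n≢0 = ℚ.≢-nonZero (w≢0 ∘ vecNorm≡0⇒≡0 δs>0 vw)
    m≢0 : ℚ.NonZero (vecNorm (conj w))
    m≢0 = ℚ.≢-nonZero (conj-w≢0 ∘ vecNorm≡0⇒≡0 δs>0 (isVec-conj vw))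
  r l : Cl _
  r = sc (ℚ.1/ vecNorm w) *K conj w
  l = sc (ℚ.1/ vecNorm (conj w)) *K conj w
  w*r≡1 : w *K r ≡ 1K
  w*r≡1 = trans (sc-commute _ w _) (sc-1/-cancel (vecNorm w) (vec*conj≡vecNorm vw))
  l*w≡1 : l *K w ≡ 1K
  l*w≡1 = trans (*-assoc _ _ w) (sc-1/-cancel (vecNorm (conj w)) (conj-vec*vec≡vecNorm vw))
  r*w≡1 : r *K w ≡ 1K
  r*w≡1 = subst (λ t → t *K w ≡ 1K) (left-inverse≡right-inverse l*w≡1 w*r≡1) l*w≡1

isInverseOf-neg : ∀ {x y : Cl ds} → y IsInverseOf x → (-K y) IsInverseOf (-K x)
isInverseOf-neg {x = x} {y} (yx≡1 , xy≡1) = trans (neg*neg y x) yx≡1 , trans (neg*neg x y) xy≡1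

isInverseOf-* : ∀ {x y x′ y′ : Cl ds} → y IsInverseOf x → y′ IsInverseOf x′ → (y′ *K y) IsInverseOf (x *K x′)
isInverseOf-* {x = x} {y} {x′} {y′} (yx≡1 , xy≡1) (y′x′≡1 , x′y′≡1) =
  cancel y′ y x x′ yx≡1 y′x′≡1 , cancel x x′ y′ y x′y′≡1 xy≡1
  where
  open ≡-Reasoning
  cancel : ∀ a b c d → b *K c ≡ 1K → a *K d ≡ 1K → a *K b *K (c *K d) ≡ 1K
  cancel a b c d bc≡1 ad≡1 = begin
    a *K b *K (c *K d)     ≡⟨ *-assoc a b _ ⟩
    a *K (b *K (c *K d))   ≡⟨ cong (a *K_) (*-assoc b c d) ⟨
    a *K (b *K c *K d)     ≡⟨ cong (λ t → a *K (t *K d)) bc≡1 ⟩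
    a *K (1K *K d)         ≡⟨ cong (a *K_) (*-identityˡ d) ⟩
    a *K d                 ≡⟨ ad≡1 ⟩
    1K                     ∎

sc-1/-isInverseOf : ∀ p .{{_ : ℚ.NonZero p}} → sc (ℚ.1/ p) IsInverseOf sc {ds} p
sc-1/-isInverseOf p = sc-1/-cancel p refl , trans (sym (sc-* p _)) (cong sc (ℚ.*-inverseʳ p))

invertible⇒¬zeroDivisor : ∀ {c ci : Cl ds} → ci IsInverseOf c → ¬ ZeroDivisor c
invertible⇒¬zeroDivisor {c = c} {ci} (ci*c≡1 , c*ci≡1) (y , y≢0 , inj₁ cy≡0) = y≢0 (begin
  y               ≡⟨ *-identityˡ y ⟨
  1K *K y         ≡⟨ cong (_*K y) ci*c≡1 ⟨
  ci *K c *K y    ≡⟨ *-assoc ci c y ⟩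
  ci *K (c *K y)  ≡⟨ cong (ci *K_) cy≡0 ⟩
  ci *K 0K        ≡⟨ zeroʳ ci ⟩
  0K              ∎)
  where open ≡-Reasoning
invertible⇒¬zeroDivisor {c = c} {ci} (ci*c≡1 , c*ci≡1) (y , y≢0 , inj₂ yc≡0) = y≢0 (begin
  y               ≡⟨ *-identityʳ y ⟨
  y *K 1K         ≡⟨ cong (y *K_) c*ci≡1 ⟨
  y *K (c *K ci)  ≡⟨ *-assoc y c ci ⟨
  y *K c *K ci    ≡⟨ cong (_*K ci) yc≡0 ⟩
  0K *K ci        ≡⟨ zeroˡ ci ⟩
  0K              ∎)
  where open ≡-Reasoning

euclid-remainder : ∀ {c v q r : Cl ds} → c *K v ≡ c *K q +K r → r ≡ c *K (v -K q)
euclid-remainder {c = c} {v} {q} {r} cv≡cq+r = begin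
  r                        ≡⟨ xyx⁻¹≈y (c *K q) r ⟨
  c *K q +K r -K c *K q    ≡⟨ cong (_-K c *K q) cv≡cq+r ⟨
  c *K v -K c *K q         ≡⟨ x[y-z]≈xy-xz c v q ⟨
  c *K (v -K q)            ∎
  where open ≡-Reasoning

remainder-isInverseOf : ∀ {c ci v q r w⁻¹ : Cl ds} → ci IsInverseOf c → w⁻¹ IsInverseOf (v -K q) →
                        c *K v ≡ c *K q +K r → (w⁻¹ *K ci) IsInverseOf r
remainder-isInverseOf {ci = ci} {w⁻¹ = w⁻¹} ci⁻¹ w⁻¹-inv cv≡cq+r =
  subst ((w⁻¹ *K ci) IsInverseOf_) (sym (euclid-remainder cv≡cq+r)) (isInverseOf-* ci⁻¹ w⁻¹-inv)

remainder*-inverse : ∀ {c v q r w⁻¹ : Cl ds} → w⁻¹ IsInverseOf (v -K q) →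
                     c *K v ≡ c *K q +K r → r *K (-K w⁻¹) ≡ -K c
remainder*-inverse {c = c} {v} {q} {r} {w⁻¹} (_ , w*w⁻¹≡1) cv≡cq+r = begin
  r *K (-K w⁻¹)                ≡⟨ -‿distribʳ-* r w⁻¹ ⟨
  -K (r *K w⁻¹)                ≡⟨ cong (λ t → -K (t *K w⁻¹)) (euclid-remainder cv≡cq+r) ⟩
  -K (c *K (v -K q) *K w⁻¹)    ≡⟨ cong -K_ (*-assoc c _ w⁻¹) ⟩
  -K (c *K ((v -K q) *K w⁻¹))  ≡⟨ cong (λ t → -K (c *K t)) w*w⁻¹≡1 ⟩
  -K (c *K 1K)                 ≡⟨ cong -K_ (*-identityʳ c) ⟩
  -K c                         ∎
  where open ≡-Reasoning

x-[-[y-x]]≡y : ∀ (x y : Cl ds) → x -K (-K (y -K x)) ≡ y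
x-[-[y-x]]≡y x y = begin
  x -K (-K (y -K x))   ≡⟨ cong (x +K_) (-‿involutive _) ⟩
  x +K (y -K x)        ≡⟨ x+[y+z]≡y+[x+z] x y (-K x) ⟩
  y +K (x -K x)        ≡⟨ cong (y +K_) (-‿inverseʳ x) ⟩
  y +K 0K              ≡⟨ +-identityʳ y ⟩
  y                    ∎
  where open ≡-Reasoning

-- Orders: integral coordinates and denominators

module _ {ds : List ℕ} where
  open RawSemiringDefinitions (Semiring.rawSemiring (Ring.semiring (ring {ds}))) public using () renaming (_^_ to _^ᴷ_)

*conj-^ : ∀ {x : Cl ds} {s} → x *K conj x ≡ sc s → ∀ k → (x ^ᴷ k) *K conj (x ^ᴷ k) ≡ sc (s ^ k)
*conj-^ {x = x} {s} _    zero    = trans (cong (1K *K_) (conj-sc 1ℚ)) (*-identityʳ 1K)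
*conj-^ {x = x} {s} xx̄≡s (suc k) = begin
  x *K y *K conj (x *K y)           ≡⟨ cong (x *K y *K_) (conj-* x y) ⟩
  x *K y *K (conj y *K conj x)      ≡⟨ *-assoc (x *K y) _ _ ⟨
  x *K y *K conj y *K conj x        ≡⟨ cong (_*K conj x) (*-assoc x y _) ⟩
  x *K (y *K conj y) *K conj x      ≡⟨ cong (λ t → x *K t *K conj x) (*conj-^ xx̄≡s k) ⟩
  x *K sc (s ^ k) *K conj x         ≡⟨ sc-sandwich _ x _ ⟩
  sc (s ^ k) *K (x *K conj x)       ≡⟨ cong (sc (s ^ k) *K_) xx̄≡s ⟩
  sc (s ^ k) *K sc s                ≡⟨ sc-* _ s ⟨
  sc (s ^ k ℚ.* s)                  ≡⟨ cong sc (ℚ.*-comm _ s) ⟩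
  sc (s ^ suc k)                    ∎
  where
  open ≡-Reasoning
  y = x ^ᴷ k

IntegralCoords : Cl ds → Set
IntegralCoords {[]}    q       = IsInteger q
IntegralCoords {_ ∷ _} (a , b) = IntegralCoords a × IntegralCoords b

integralCoords-sc : ∀ {p} → IsInteger p → IntegralCoords (sc {ds} p)
integralCoords-sc {[]}     ip = ip
integralCoords-sc {_ ∷ ds} ip = integralCoords-sc ip , integralCoords-sc {ds} (+ 0 , refl)

integralCoords-sc⁻ : ∀ {p} → IntegralCoords (sc {ds} p) → IsInteger p
integralCoords-sc⁻ {[]}     ip       = ip
integralCoords-sc⁻ {_ ∷ ds} (ip , _) = integralCoords-sc⁻ {ds} ip

integralCoords-+ : ∀ {x y : Cl ds} → IntegralCoords x → IntegralCoords y → IntegralCoords (x +K y)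
integralCoords-+ {[]}                   ix        iy        = isInteger-+ ix iy
integralCoords-+ {_ ∷ _} {_ , _} {_ , _} (ia , ib) (ic , ie) = integralCoords-+ ia ic , integralCoords-+ ib ie

integralCoords-neg : ∀ {x : Cl ds} → IntegralCoords x → IntegralCoords (-K x)
integralCoords-neg {[]}             ix        = isInteger-neg ix
integralCoords-neg {_ ∷ _} {_ , _} (ia , ib) = integralCoords-neg ia , integralCoords-neg ib

integralCoords-parity : ∀ {x : Cl ds} → IntegralCoords x → IntegralCoords (parity x)
integralCoords-parity {[]}             ix        = ix
integralCoords-parity {_ ∷ _} {_ , _} (ia , ib) =
  integralCoords-parity ia , integralCoords-neg (integralCoords-parity ib)

integralCoords-star : ∀ {x : Cl ds} → IntegralCoords x → IntegralCoords (star x)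
integralCoords-star {[]}             ix        = ix
integralCoords-star {_ ∷ _} {_ , _} (ia , ib) =
  integralCoords-star ia , integralCoords-parity (integralCoords-star ib)

integralCoords-conj : ∀ {x : Cl ds} → IntegralCoords x → IntegralCoords (conj x)
integralCoords-conj ix = integralCoords-star (integralCoords-parity ix)

integralCoords-* : ∀ {x y : Cl ds} → IntegralCoords x → IntegralCoords y → IntegralCoords (x *K y)
integralCoords-* {[]}                    ix        iy        = isInteger-* ix iy
integralCoords-* {δ ∷ _} {_ , _} {_ , _} (ia , ib) (ic , ie) =
  integralCoords-+ (integralCoords-* ia ic)
    (integralCoords-neg (integralCoords-* (integralCoords-sc (+ δ , refl))
                                          (integralCoords-* ib (integralCoords-parity ie)))) ,
  integralCoords-+ (integralCoords-* ia ie) (integralCoords-* ib (integralCoords-parity ic))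

_Clears_ : ℕ → Cl ds → Set
n Clears x = IntegralCoords (sc (fromℕ n) *K x)

clears-*ˡ : ∀ m {n} {x : Cl ds} → n Clears x → (m ℕ.* n) Clears x
clears-*ˡ m {n} {x} n∣x = subst IntegralCoords (sym (begin
  sc (fromℕ (m ℕ.* n)) *K x             ≡⟨ cong (λ t → sc t *K x) (fromℕ-* m n) ⟩
  sc (fromℕ m ℚ.* fromℕ n) *K x         ≡⟨ cong (_*K x) (sc-* _ _) ⟩
  sc (fromℕ m) *K sc (fromℕ n) *K x     ≡⟨ *-assoc _ _ x ⟩
  sc (fromℕ m) *K (sc (fromℕ n) *K x)   ∎))
  (integralCoords-* (integralCoords-sc (+ m , refl)) n∣x)
  where open ≡-Reasoning

clears-*ʳ : ∀ m {n} {x : Cl ds} → n Clears x → (n ℕ.* m) Clears x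
clears-*ʳ m {n} {x} n∣x = subst (_Clears x) (ℕ.*-comm m n) (clears-*ˡ m n∣x)

clears-norm : ∀ {n} {y : Cl ds} {t} → n Clears y → y *K conj y ≡ sc t → IsInteger (fromℕ (n ℕ.* n) ℚ.* t)
clears-norm {ds} {n} {y} {t} ny yȳ≡t =
  integralCoords-sc⁻ {ds} (subst IntegralCoords ny*conj-ny≡ (integralCoords-* ny (integralCoords-conj ny)))
  where
  open ≡-Reasoning
  N = fromℕ n
  ny*conj-ny≡ : sc N *K y *K conj (sc N *K y) ≡ sc (fromℕ (n ℕ.* n) ℚ.* t)
  ny*conj-ny≡ = begin
    sc N *K y *K conj (sc N *K y)     ≡⟨ cong (sc N *K y *K_) (trans (conj-* _ y) (cong (conj y *K_) (conj-sc N))) ⟩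
    sc N *K y *K (conj y *K sc N)     ≡⟨ trans (*-assoc _ y _) (cong (sc N *K_) (sym (*-assoc y _ _))) ⟩
    sc N *K (y *K conj y *K sc N)     ≡⟨ cong (λ u → sc N *K (u *K sc N)) yȳ≡t ⟩
    sc N *K (sc t *K sc N)            ≡⟨ trans (cong (sc N *K_) (sym (sc-* t N))) (sym (sc-* N _)) ⟩
    sc (N ℚ.* (t ℚ.* N))              ≡⟨ cong sc (trans (cong (N ℚ.*_) (ℚ.*-comm t N)) (sym (ℚ.*-assoc N N t))) ⟩
    sc (N ℚ.* N ℚ.* t)                ≡⟨ cong (λ u → sc (u ℚ.* t)) (fromℕ-* n n) ⟨
    sc (fromℕ (n ℕ.* n) ℚ.* t)        ∎

∃-clears : ∀ (x : Cl ds) → ∃ λ m → suc m Clears x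
∃-clears {[]}     q       = ℚ.ℚ.denominator-1 q , ℚ.↥ q , ↧*≡↥ q
∃-clears {δ ∷ ds} (a , b) with ∃-clears a | ∃-clears b
... | ma , ca | mb , cb = mb ℕ.+ ma ℕ.* suc mb ,
  subst (IntegralCoords {δ ∷ ds}) (sym (sc*-pair δ (fromℕ (suc ma ℕ.* suc mb)) a b))
        (clears-*ʳ (suc mb) {suc ma} ca , clears-*ˡ (suc ma) {suc mb} cb)

∃-clears-all : ∀ (xs : List (Cl ds)) → ∃ λ m → All (suc m Clears_) xs
∃-clears-all []       = 0 , []
∃-clears-all (x ∷ xs) with ∃-clears x | ∃-clears-all xs
... | m , cx | m′ , cxs = m′ ℕ.+ m ℕ.* suc m′ ,
  clears-*ʳ (suc m′) {suc m} cx ∷ All.map (clears-*ˡ (suc m) {suc m′}) cxs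

clears-linComb : ∀ {n} {es : List (Cl ds)} → All (n Clears_) es → ∀ zs → n Clears linComb (map fromℤ zs) es
clears-linComb _          []       = subst IntegralCoords (sym (zeroʳ _)) (integralCoords-sc (+ 0 , refl))
clears-linComb []         (_ ∷ _)  = subst IntegralCoords (sym (zeroʳ _)) (integralCoords-sc (+ 0 , refl))
clears-linComb {n = n} {e ∷ es} (ce ∷ ces) (z ∷ zs) = subst IntegralCoords (sym (begin
  sc (fromℕ n) *K (sc (fromℤ z) *K e +K rest)
    ≡⟨ distribˡ _ _ _ ⟩
  sc (fromℕ n) *K (sc (fromℤ z) *K e) +K sc (fromℕ n) *K rest
    ≡⟨ cong (_+K sc (fromℕ n) *K rest) (sc-commute _ _ e) ⟩
  sc (fromℤ z) *K (sc (fromℕ n) *K e) +K sc (fromℕ n) *K rest ∎))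
  (integralCoords-+ (integralCoords-* (integralCoords-sc (z , refl)) ce) (clears-linComb {n = n} ces zs))
  where
  open ≡-Reasoning
  rest = linComb (map fromℤ zs) es

linComb-sc* : ∀ p qs (es : List (Cl ds)) → sc p *K linComb qs es ≡ linComb (map (p ℚ.*_) qs) es
linComb-sc* p []       _        = zeroʳ _
linComb-sc* p (_ ∷ _)  []       = zeroʳ _
linComb-sc* p (q ∷ qs) (e ∷ es) = trans (distribˡ _ _ _)
  (cong₂ _+K_ (trans (sym (*-assoc _ _ e)) (cong (_*K e) (sym (sc-* p q)))) (linComb-sc* p qs es))

integer-coefficients : ∀ p {qs} → All (λ q → IsInteger (p ℚ.* q)) qs →
                       Σ (List ℤ) λ zs → map (p ℚ.*_) qs ≡ map fromℤ zs
integer-coefficients p []               = [] , refl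
integer-coefficients p ((z , eq) ∷ iqs) = z ∷ proj₁ rest , cong₂ _∷_ eq (proj₂ rest)
  where rest = integer-coefficients p iqs

module Order {R : Subset ds} (O : IsOrder R) where
  open IsOrder O

  private
    es = proj₁ lattice
    R⇔ℤ-span = proj₁ (proj₂ lattice)
    K⊆ℚ-span = proj₂ (proj₂ lattice)

  0∈ : R 0K
  0∈ = subst R (-‿inverseʳ 1K) (+-closed one∈ (neg-closed one∈))

  fromℕ∈ : ∀ n → R (sc (fromℕ n))
  fromℕ∈ zero    = 0∈
  fromℕ∈ (suc n) = subst R (sym sc-suc) (+-closed one∈ (fromℕ∈ n))
    where
    sc-suc : sc (fromℕ (suc n)) ≡ 1K +K sc (fromℕ n)
    sc-suc = trans (cong sc (trans (cong fromℤ (ℤ.pos-+ 1 n)) (fromℤ-+ (+ 1) (+ n)))) (sc-+ _ _)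

  ^ᴷ∈ : ∀ {x} → R x → ∀ k → R (x ^ᴷ k)
  ^ᴷ∈ x∈R zero    = one∈
  ^ᴷ∈ x∈R (suc k) = *-closed x∈R (^ᴷ∈ x∈R k)

  common-denominator : ∃ λ m → ∀ {x} → R x → suc m Clears x
  common-denominator with ∃-clears-all es
  ... | m , ces = m , λ {x} x∈R → let zs , x≡ = Equivalence.to (R⇔ℤ-span x) x∈R in
                    subst (suc m Clears_) (sym x≡) (clears-linComb {n = suc m} ces zs)

  -- suc (m + m * suc m) is (suc m)², the square of a common denominator of R.
  norm-integral : ∀ {x} → R x → IsScalar (x *K conj x) → IsInt (x *K conj x)
  norm-integral {x} x∈R xx̄≡s = xx̄≡s , bounded-powers⇒isInteger (m ℕ.+ m ℕ.* suc m) s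
    (λ k → clears-norm {n = suc m} (proj₂ common-denominator (^ᴷ∈ x∈R k)) (*conj-^ xx̄≡s k))
    where
    m = proj₁ common-denominator
    s = scalarPart (x *K conj x)

  clear-denominator : ∀ v → ∃ λ m → R (sc (fromℕ (suc m)) *K v)
  clear-denominator v with K⊆ℚ-span v
  ... | qs , v≡ with ∃-clears-all {[]} qs      -- over Cl [] = ℚ: a common denominator of the coefficients
  ... | m , cqs with integer-coefficients (fromℕ (suc m)) cqs
  ... | zs , eqs = m , Equivalence.from (R⇔ℤ-span _) (zs , (begin
    sc (fromℕ (suc m)) *K v                         ≡⟨ cong (sc (fromℕ (suc m)) *K_) v≡ ⟩
    sc (fromℕ (suc m)) *K linComb qs es             ≡⟨ linComb-sc* _ qs es ⟩
    linComb (map (fromℕ (suc m) ℚ.*_) qs) es        ≡⟨ cong (λ ps → linComb ps es) eqs ⟩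
    linComb (map fromℤ zs) es                       ∎))
    where open ≡-Reasoning

-- SL₂(R) and cusps

-- How the forms defining SL₂ change when (b , d) becomes (a q + b , c q + d).
mixed-expansion : ∀ (a b c d q x : Cl ds) →
  a *K x *K conj (c *K q +K d) +K (a *K q +K b) *K conj x *K conj c
  ≡ a *K (x *K conj q +K q *K conj x) *K conj c +K (a *K x *K conj d +K b *K conj x *K conj c)
mixed-expansion a b c d q x = begin
  a *K x *K conj (c *K q +K d) +K (a *K q +K b) *K conj x *K conj c
    ≡⟨ cong₂ (λ u t → a *K x *K u +K t *K conj c)
             (trans (conj-+ _ d) (cong (_+K conj d) (conj-* c q))) (distribʳ _ _ _) ⟩
  a *K x *K (conj q *K conj c +K conj d) +K (a *K q *K conj x +K b *K conj x) *K conj c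
    ≡⟨ cong₂ _+K_ (distribˡ _ _ _) (distribʳ _ _ _) ⟩
  (a *K x *K (conj q *K conj c) +K a *K x *K conj d) +K (a *K q *K conj x *K conj c +K b *K conj x *K conj c)
    ≡⟨ +-interchange _ _ _ _ ⟩
  (a *K x *K (conj q *K conj c) +K a *K q *K conj x *K conj c) +K (a *K x *K conj d +K b *K conj x *K conj c)
    ≡⟨ cong (_+K (a *K x *K conj d +K b *K conj x *K conj c))
            (cong₂ _+K_ (trans (sym (*-assoc _ _ _)) (cong (_*K conj c) (*-assoc a x _)))
                        (cong (_*K conj c) (*-assoc a q _))) ⟩
  (a *K (x *K conj q) *K conj c +K a *K (q *K conj x) *K conj c) +K (a *K x *K conj d +K b *K conj x *K conj c)
    ≡⟨ cong (_+K (a *K x *K conj d +K b *K conj x *K conj c))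
            (trans (sym (distribʳ _ _ _)) (cong (_*K conj c) (sym (distribˡ a _ _)))) ⟩
  a *K (x *K conj q +K q *K conj x) *K conj c +K (a *K x *K conj d +K b *K conj x *K conj c) ∎
  where open ≡-Reasoning

norm-expansion : ∀ (a b c d q : Cl ds) →
  (a *K q +K b) *K conj (c *K q +K d)
  ≡ (a *K (q *K conj q) *K conj c +K (a *K q *K conj d +K b *K conj q *K conj c)) +K b *K conj d
norm-expansion a b c d q = begin
  (a *K q +K b) *K conj (c *K q +K d)
    ≡⟨ cong ((a *K q +K b) *K_) (trans (conj-+ _ d) (cong (_+K conj d) (conj-* c q))) ⟩
  (a *K q +K b) *K (conj q *K conj c +K conj d)
    ≡⟨ trans (distribˡ _ _ _) (cong₂ _+K_ (distribʳ _ _ _) (distribʳ _ _ _)) ⟩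
  (a *K q *K (conj q *K conj c) +K b *K (conj q *K conj c)) +K (a *K q *K conj d +K b *K conj d)
    ≡⟨ +-assoc _ _ _ ⟩
  a *K q *K (conj q *K conj c) +K (b *K (conj q *K conj c) +K (a *K q *K conj d +K b *K conj d))
    ≡⟨ cong (_ +K_) (trans (x+[y+z]≡y+[x+z] _ _ _) (sym (+-assoc _ _ _))) ⟩
  a *K q *K (conj q *K conj c) +K ((a *K q *K conj d +K b *K (conj q *K conj c)) +K b *K conj d)
    ≡⟨ sym (+-assoc _ _ _) ⟩
  (a *K q *K (conj q *K conj c) +K (a *K q *K conj d +K b *K (conj q *K conj c))) +K b *K conj d
    ≡⟨ cong₂ (λ u t → (u +K (a *K q *K conj d +K t)) +K b *K conj d)
             (trans (sym (*-assoc _ _ _)) (cong (_*K conj c) (*-assoc a q _))) (sym (*-assoc b _ _)) ⟩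
  (a *K (q *K conj q) *K conj c +K (a *K q *K conj d +K b *K conj q *K conj c)) +K b *K conj d ∎
  where open ≡-Reasoning

sandwich-isScalar : ∀ {u y v : Cl ds} → IsScalar y → IsScalar (u *K conj v) → IsScalar (u *K y *K conj v)
sandwich-isScalar {u = u} {y} {v} sy s = subst IsScalar (sym (scalar-sandwich u (conj v) sy)) (isScalar-sc* _ s)

sandwich-isVec : ∀ {u y v : Cl ds} → IsScalar y → IsVec (u *K conj v) → IsVec (u *K y *K conj v)
sandwich-isVec {u = u} {y} {v} sy s = subst IsVec (sym (scalar-sandwich u (conj v) sy)) (isVec-sc* _ s)

neg*conj-neg : ∀ (u v : Cl ds) → (-K u) *K conj (-K v) ≡ u *K conj v
neg*conj-neg u v = trans (cong ((-K u) *K_) (conj-neg v)) (neg*neg u _)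

-- The forms of (-b a; -d c) at x are minus those of (a b; c d) at x̄.
swap-form : ∀ (u v w t x : Cl ds) →
  (-K u) *K x *K conj v +K w *K conj x *K conj (-K t)
  ≡ -K (w *K conj x *K conj t +K u *K conj (conj x) *K conj v)
swap-form u v w t x = begin
  (-K u) *K x *K conj v +K w *K conj x *K conj (-K t)
    ≡⟨ cong₂ _+K_ (trans (cong (_*K conj v) (sym (-‿distribˡ-* u x))) (sym (-‿distribˡ-* _ _)))
                  (trans (cong (w *K conj x *K_) (conj-neg t)) (sym (-‿distribʳ-* _ _))) ⟩
  -K (u *K x *K conj v) +K -K (w *K conj x *K conj t)
    ≡⟨ trans (+-comm _ _) (-‿+-comm _ _) ⟩
  -K (w *K conj x *K conj t +K u *K x *K conj v)
    ≡⟨ cong (λ y → -K (w *K conj x *K conj t +K u *K y *K conj v)) (conj-involutive x) ⟨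
  -K (w *K conj x *K conj t +K u *K conj (conj x) *K conj v) ∎
  where open ≡-Reasoning

IsCusp : Subset ds → Cl ds → Set
IsCusp {ds} R v =
  Σ (Cl ds) λ a → Σ (Cl ds) λ b → Σ (Cl ds) λ c → Σ (Cl ds) λ d →
    SL₂ R a b c d ×
    Σ (Cl ds) λ cinv → (cinv *K c ≡ 1K) × (c *K cinv ≡ 1K) × (cinv *K d ≡ v)

module SL₂-Operations {ds : List ℕ} {R : Subset ds} (O : IsOrder R) where
  open IsOrder O
  open Order O

  isInt-norm : ∀ {x p} → R x → x *K conj x ≡ sc p → IsInt (x *K conj x)
  isInt-norm x∈R xx̄≡p = norm-integral x∈R (≡sc⇒isScalar xx̄≡p)

  SL₂-identity : SL₂ R 1K 0K 0K 1K
  SL₂-identity = record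
    { a∈ = one∈ ; b∈ = 0∈ ; c∈ = 0∈ ; d∈ = one∈
    ; det = trans (cong (_-K 0K *K star 0K) (1*sc (star-sc 1ℚ))) (x-z≡x (zeroˡ _))
    ; ab  = trans (1*sc (star-sc 0ℚ)) (sym (zeroˡ _))
    ; cd  = trans (zeroˡ _) (sym (1*sc (star-sc 0ℚ)))
    ; aa  = isInt-norm one∈ (1*sc (conj-sc 1ℚ))
    ; bb  = isInt-norm 0∈ (zeroˡ _)
    ; cc  = isInt-norm 0∈ (zeroˡ _)
    ; dd  = isInt-norm one∈ (1*sc (conj-sc 1ℚ))
    ; ac  = subst IsVec (sym (1*sc (conj-sc 0ℚ))) (isVec-sc 0ℚ)
    ; bd  = subst IsVec (sym (zeroˡ _)) (isVec-sc 0ℚ)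
    ; vab = λ x _ → ≡sc⇒isScalar (trans (cong₂ _+K_ (x*conj0 (1K *K x)) (0*y*z (conj x) _)) (+-identityˡ 0K))
    ; vcd = λ x _ → ≡sc⇒isScalar (trans (cong₂ _+K_ (0*y*z x _) (x*conj0 (1K *K conj x))) (+-identityˡ 0K))
    ; vad = λ x vx → subst IsVec (sym (trans (cong₂ _+K_ (trans (cong (1K *K x *K_) (conj-sc 1ℚ))
                                                                 (trans (*-identityʳ _) (*-identityˡ x)))
                                                          (0*y*z (conj x) _))
                                             (+-identityʳ x))) vx
    }
    where
    1*sc : ∀ {y : Cl ds} {p} → y ≡ sc p → 1K *K y ≡ sc p
    1*sc refl = *-identityˡ _
    x*conj0 : ∀ (x : Cl ds) → x *K conj 0K ≡ 0K
    x*conj0 x = trans (cong (x *K_) (conj-sc 0ℚ)) (zeroʳ x)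
    0*y*z : ∀ (y z : Cl ds) → 0K *K y *K z ≡ 0K
    0*y*z y z = trans (cong (_*K z) (zeroˡ y)) (zeroˡ z)

  SL₂-swap : ∀ {a b c d} → SL₂ R a b c d → SL₂ R (-K b) a (-K d) c
  SL₂-swap {a} {b} {c} {d} M = record
    { a∈ = neg-closed b∈ ; b∈ = a∈ ; c∈ = neg-closed d∈ ; d∈ = c∈
    ; det = begin
        (-K b) *K star c -K a *K star (-K d)
          ≡⟨ cong₂ _-K_ (sym (-‿distribˡ-* b _)) (trans (cong (a *K_) (star-neg d)) (sym (-‿distribʳ-* a _))) ⟩
        -K (b *K star c) -K (-K (a *K star d))
          ≡⟨ trans (cong (-K (b *K star c) +K_) (-‿involutive _)) (+-comm _ _) ⟩
        a *K star d -K b *K star c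
          ≡⟨ det ⟩
        1K ∎
    ; ab  = anti b a ab
    ; cd  = anti d c cd
    ; aa  = subst IsInt (sym (neg*conj-neg b b)) bb
    ; bb  = aa
    ; cc  = subst IsInt (sym (neg*conj-neg d d)) dd
    ; dd  = cc
    ; ac  = subst IsVec (sym (neg*conj-neg b d)) bd
    ; bd  = ac
    ; vab = λ x vx → subst IsScalar (sym (swap-form b a a b x)) (isScalar-neg (vab (conj x) (isVec-conj vx)))
    ; vcd = λ x vx → subst IsScalar (sym (swap-form d c c d x)) (isScalar-neg (vcd (conj x) (isVec-conj vx)))
    ; vad = λ x vx → subst IsVec (sym (swap-form b c a d x)) (isVec-neg (vad (conj x) (isVec-conj vx)))
    }
    where
    open SL₂ M
    open ≡-Reasoning
    anti : ∀ u v → v *K star u ≡ u *K star v → (-K u) *K star v ≡ v *K star (-K u)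
    anti u v vu*≡uv* = begin
      (-K u) *K star v      ≡⟨ -‿distribˡ-* u _ ⟨
      -K (u *K star v)      ≡⟨ cong -K_ vu*≡uv* ⟨
      -K (v *K star u)      ≡⟨ -‿distribʳ-* v _ ⟩
      v *K (-K star u)      ≡⟨ cong (v *K_) (star-neg u) ⟨
      v *K star (-K u)      ∎

  SL₂-translate : ∀ {a b c d q} → VecR R q → SL₂ R a b c d → SL₂ R a (a *K q +K b) c (c *K q +K d)
  SL₂-translate {a} {b} {c} {d} {q} (q∈R , vq) M = record
    { a∈ = a∈ ; b∈ = +-closed (*-closed a∈ q∈R) b∈ ; c∈ = c∈ ; d∈ = +-closed (*-closed c∈ q∈R) d∈
    ; det = begin
        a *K star (c *K q +K d) -K (a *K q +K b) *K star c
          ≡⟨ cong₂ (λ u t → a *K u -K t) (star-affine c d) (distribʳ _ _ _) ⟩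
        a *K (q *K star c +K star d) -K (a *K q *K star c +K b *K star c)
          ≡⟨ cong (_-K (a *K q *K star c +K b *K star c))
                  (trans (distribˡ a _ _) (cong (_+K a *K star d) (sym (*-assoc a q _)))) ⟩
        (a *K q *K star c +K a *K star d) -K (a *K q *K star c +K b *K star c)
          ≡⟨ [x+y]-[x+z]≡y-z _ _ _ ⟩
        a *K star d -K b *K star c
          ≡⟨ det ⟩
        1K ∎
    ; ab  = symmetric a b ab
    ; cd  = symmetric c d cd
    ; aa  = aa
    ; bb  = norm-integral (+-closed (*-closed a∈ q∈R) b∈) (subst IsScalar (sym (norm-expansion a b a b q))
              (isScalar-+ (isScalar-+ (sandwich-isScalar q-norm (proj₁ aa)) (vab q vq)) (proj₁ bb)))
    ; cc  = cc
    ; dd  = norm-integral (+-closed (*-closed c∈ q∈R) d∈) (subst IsScalar (sym (norm-expansion c d c d q))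
              (isScalar-+ (isScalar-+ (sandwich-isScalar q-norm (proj₁ cc)) (vcd q vq)) (proj₁ dd)))
    ; ac  = ac
    ; bd  = subst IsVec (sym (norm-expansion a b c d q))
              (isVec-+ (isVec-+ (sandwich-isVec q-norm ac) (vad q vq)) bd)
    ; vab = λ x vx → subst IsScalar (sym (mixed-expansion a b a b q x))
              (isScalar-+ (sandwich-isScalar (vec-polarization vx vq) (proj₁ aa)) (vab x vx))
    ; vcd = λ x vx → subst IsScalar (sym (mixed-expansion c d c d q x))
              (isScalar-+ (sandwich-isScalar (vec-polarization vx vq) (proj₁ cc)) (vcd x vx))
    ; vad = λ x vx → subst IsVec (sym (mixed-expansion a b c d q x))
              (isVec-+ (sandwich-isVec (vec-polarization vx vq) ac) (vad x vx))
    }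
    where
    open SL₂ M
    open ≡-Reasoning
    q-norm : IsScalar (q *K conj q)
    q-norm = ≡sc⇒isScalar (vec*conj≡vecNorm vq)
    star-affine : ∀ u v → star (u *K q +K v) ≡ q *K star u +K star v
    star-affine u v = trans (star-+ _ v) (cong (_+K star v) (trans (star-* u q) (cong (_*K star u) (star-vec vq))))
    symmetric : ∀ u v → u *K star v ≡ v *K star u → u *K star (u *K q +K v) ≡ (u *K q +K v) *K star u
    symmetric u v uv*≡vu* = begin
      u *K star (u *K q +K v)               ≡⟨ trans (cong (u *K_) (star-affine u v)) (distribˡ u _ _) ⟩
      u *K (q *K star u) +K u *K star v     ≡⟨ cong₂ _+K_ (sym (*-assoc u q _)) uv*≡vu* ⟩
      u *K q *K star u +K v *K star u       ≡⟨ distribʳ _ _ _ ⟨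
      (u *K q +K v) *K star u               ∎

  vecR-isCusp : ∀ {q} → VecR R q → IsCusp R q
  vecR-isCusp {q} q∈VecR =
    _ , _ , _ , _ , SL₂-translate q∈VecR (SL₂-swap SL₂-identity) , -K 1K , -1*-1≡1 , -1*-1≡1 , -1*[-q+0]≡q
    where
    -1*-1≡1 : (-K 1K) *K (-K 1K) ≡ 1K
    -1*-1≡1 = trans (neg*neg 1K 1K) (*-identityʳ 1K)
    -1*[-q+0]≡q : (-K 1K) *K ((-K 1K) *K q +K 0K) ≡ q
    -1*[-q+0]≡q = trans (cong ((-K 1K) *K_) (+-identityʳ _))
      (trans (sym (*-assoc _ _ q)) (trans (cong (_*K q) -1*-1≡1) (*-identityˡ q)))

  -- The Möbius action of (0 1; -1 0) followed by translation by q: u ↦ q - u⁻¹.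
  isCusp-step : ∀ {q u u′} → VecR R q → IsCusp R u → u′ IsInverseOf u → IsCusp R (q -K u′)
  isCusp-step {q} {u} {u′} q∈VecR (a , b , c , d , M , ci , ci*c≡1 , c*ci≡1 , ci*d≡u) u′⁻¹ =
    _ , _ , _ , _ , SL₂-translate q∈VecR (SL₂-swap M) , ci′ , proj₁ ci′⁻¹ , proj₂ ci′⁻¹ , ci′*d′≡q-u′
    where
    open ≡-Reasoning
    ci′ = (-K u′) *K ci
    d≡cu : d ≡ c *K u
    d≡cu = begin
      d               ≡⟨ *-identityˡ d ⟨
      1K *K d         ≡⟨ cong (_*K d) c*ci≡1 ⟨
      c *K ci *K d    ≡⟨ *-assoc c ci d ⟩
      c *K (ci *K d)  ≡⟨ cong (c *K_) ci*d≡u ⟩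
      c *K u          ∎
    ci′⁻¹ : ci′ IsInverseOf (-K d)
    ci′⁻¹ = subst (ci′ IsInverseOf_) (trans (sym (-‿distribʳ-* c u)) (cong -K_ (sym d≡cu)))
                  (isInverseOf-* (ci*c≡1 , c*ci≡1) (isInverseOf-neg u′⁻¹))
    ci′*d′≡q-u′ : ci′ *K ((-K d) *K q +K c) ≡ q -K u′
    ci′*d′≡q-u′ = begin
      ci′ *K ((-K d) *K q +K c)                ≡⟨ distribˡ ci′ _ c ⟩
      ci′ *K ((-K d) *K q) +K ci′ *K c         ≡⟨ cong₂ _+K_ (*-assoc ci′ _ q) (sym (*-assoc (-K u′) ci c)) ⟨
      ci′ *K (-K d) *K q +K (-K u′) *K (ci *K c) ≡⟨ cong₂ (λ s t → s *K q +K (-K u′) *K t) (proj₁ ci′⁻¹) ci*c≡1 ⟩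
      1K *K q +K (-K u′) *K 1K                 ≡⟨ cong₂ _+K_ (*-identityˡ q) (*-identityʳ _) ⟩
      q -K u′                                  ∎

module Descent {ds : List ℕ} (δs>0 : All (0 <_) ds) {R : Subset ds}
               (O : IsOrder R) (ss : StarStable R) (E : RightCliffordEuclidean R) where
  open IsOrder O
  open SL₂-Operations O

  N : Cl ds → ℕ
  N = proj₁ E

  euclid : ∀ x y → Mon R x → Mon R y → 0 < N x → VecR R (x *K star y) →
           Σ (Cl ds) λ q → Σ (Cl ds) λ r → VecR R q × Mon R r × (y ≡ (x *K q) +K r) × (N r < N x)
  euclid = proj₂ (proj₂ E)

  star∈ : ∀ {x} → R x → R (star x)
  star∈ {x} x∈R = Equivalence.to (ss (star x)) (x , x∈R , refl)

  mon-sc : ∀ {p} → R (sc p) → Mon R (sc p)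
  mon-sc {p} p∈R = p∈R
    , ≡sc⇒isScalar (trans (cong (sc p *K_) (conj-sc p)) (sym (sc-* p p)))
    , λ u vu → subst IsVec (cong (sc p *K u *K_) (sym (star-sc p))) (isVec-*scalar (isScalar-sc p) (isVec-sc* p vu))

  mon-*vec : ∀ {c v} → Mon R c → IsVec v → R (c *K v) → Mon R (c *K v)
  mon-*vec {c} {v} (_ , cc̄-scalar , c-preserves) vv cv∈R = cv∈R , norm-scalar , preserves
    where
    open ≡-Reasoning
    norm-scalar : IsScalar (c *K v *K conj (c *K v))
    norm-scalar = subst IsScalar (sym (begin
      c *K v *K conj (c *K v)        ≡⟨ cong (c *K v *K_) (conj-* c v) ⟩
      c *K v *K (conj v *K conj c)   ≡⟨ *-assoc (c *K v) _ _ ⟨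
      c *K v *K conj v *K conj c     ≡⟨ cong (_*K conj c) (*-assoc c v _) ⟩
      c *K (v *K conj v) *K conj c   ∎))
      (sandwich-isScalar (≡sc⇒isScalar (vec*conj≡vecNorm vv)) cc̄-scalar)
    preserves : ∀ u → IsVec u → IsVec (c *K v *K u *K star (c *K v))
    preserves u vu = subst IsVec (sym (begin
      c *K v *K u *K star (c *K v)   ≡⟨ cong (c *K v *K u *K_) (trans (star-* c v) (cong (_*K star c) (star-vec vv))) ⟩
      c *K v *K u *K (v *K star c)   ≡⟨ *-assoc _ v _ ⟨
      c *K v *K u *K v *K star c     ≡⟨ cong (_*K star c) (trans (*-assoc _ u v) (*-assoc c v _)) ⟩
      c *K (v *K (u *K v)) *K star c ≡⟨ cong (λ t → c *K t *K star c) (*-assoc v u v) ⟨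
      c *K (v *K u *K v) *K star c   ∎))
      (c-preserves _ (vec-sandwich vv vu))

  c*star[cv]∈VecR : ∀ {c v} → Mon R c → IsVec v → R (c *K v) → VecR R (c *K star (c *K v))
  c*star[cv]∈VecR {c} {v} (c∈R , _ , c-preserves) vv cv∈R =
    *-closed c∈R (star∈ cv∈R) ,
    subst IsVec (trans (*-assoc c v _) (cong (c *K_) (sym (trans (star-* c v) (cong (_*K star c) (star-vec vv))))))
          (c-preserves v vv)

  N>0 : ∀ {c ci} → Mon R c → ci IsInverseOf c → 0 < N c
  N>0 {c} mc ci⁻¹ = ℕ.n≢0⇒n>0 (invertible⇒¬zeroDivisor ci⁻¹ ∘ Equivalence.to (proj₁ (proj₂ E) c mc))

  cusp-descent : ∀ {c ci v} → Acc _<_ (N c) → Mon R c → ci IsInverseOf c → IsVec v → R (c *K v) → IsCusp R v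
  cusp-descent {c} {ci} {v} (acc smaller) mc ci⁻¹ v-vec cv∈R
    with euclid c (c *K v) mc (mon-*vec mc v-vec cv∈R) (N>0 mc ci⁻¹) (c*star[cv]∈VecR mc v-vec cv∈R)
  ... | q , r , q∈VecR , mr , cv≡cq+r , Nr<Nc with (v -K q) ≟ 0K
  ...   | yes v-q≡0 = subst (IsCusp R) (sym (x∙y⁻¹≈ε⇒x≈y v q v-q≡0)) (vecR-isCusp q∈VecR)
  ...   | no  v-q≢0 with vec-inverse δs>0 (isVec-+ v-vec (isVec-neg (proj₂ q∈VecR))) v-q≢0
  ...     | w⁻¹ , w⁻¹-vec , w⁻¹-inv = subst (IsCusp R) (x-[-[y-x]]≡y q v)
    (isCusp-step q∈VecR
      (cusp-descent (smaller Nr<Nc) mr (remainder-isInverseOf ci⁻¹ w⁻¹-inv cv≡cq+r) (isVec-neg w⁻¹-vec)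
                    (subst R (sym (remainder*-inverse w⁻¹-inv cv≡cq+r)) (neg-closed (proj₁ mc))))
      (isInverseOf-neg (swap w⁻¹-inv)))

mainTheorem12 : (ds : List ℕ) → All (0 <_) ds → (R : Subset ds) →
    IsOrder R → StarStable R → RightCliffordEuclidean R → RightCuspidallyPrincipal R
mainTheorem12 ds δs>0 R O ss E v v-vec =
  cusp-descent (<-wellFounded (N D)) D-mon D⁻¹ v-vec Dv∈R
  where
  open Order O
  open Descent δs>0 O ss E
  m : ℕ
  m = proj₁ (clear-denominator v)
  D : Cl ds
  D = sc (fromℕ (suc m))
  Dv∈R : R (D *K v)
  Dv∈R = proj₂ (clear-denominator v)
  D-mon : Mon R D
  D-mon = mon-sc (fromℕ∈ (suc m))
  instance
    D≢0 : ℚ.NonZero (fromℕ (suc m))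
    D≢0 = fromℕ-nonZero m
  D⁻¹ : sc (ℚ.1/ fromℕ (suc m)) IsInverseOf D
  D⁻¹ = sc-1/-isInverseOf (fromℕ (suc m))
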